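{- Let $k\in\mathbb{Z}_2^\times$ with $k\neq\pm1$, let $m\in\mathbb{Z}_2$, and let $\nu=v_2\!\left(\frac{k^2-1}{4}\right)$. Then: (1) the automorphism $\gamma^m z_k$ is uniformly settled; (2) for every $n\ge \nu+1$, the number of vertices at level $n$ that do not lie in a stable cycle of $\gamma^m z_k$ is at most $2^{\nu+1}$.
   Context: $T$ is the rooted binary tree of finite words over $X=\{0,1\}$ (level $n$ = words of length $n$), $\Omega=\mathrm{Aut}(T)$, acting on the right: $v\mapsto(v)\alpha$, with $(v)(\alpha\beta)=((v)\alpha)\beta$. Every $\alpha\in\Omega$ is written uniquely $\alpha=(\alpha_0,\alpha_1)\tau$ with $\alpha_0,\alpha_1\in\Omega$, $\tau\in\{\mathrm{id},\sigma\}$ ($\sigma$ swaps $0,1$), meaning $(xv)\alpha=(x)\tau\,(v)\alpha_x$ for $x\in X$. For $m\in\mathbb{Z}_2$, $\alpha^m$ is the limit of $\alpha^{m_j}$ for integers $m_j\to m$ $2$-adically. The standard odometer $\gamma$ is defined by $\gamma=(\gamma,\mathrm{id})\sigma$. For $k\in\mathbb{Z}_2^\times$ put $\ell=(k-1)/2\in\mathbb{Z}_2$ and let $z_k\in\Omega$ be defined recursively by $z_k=(z_k,\gamma^\ell z_k)$ (trivial on level 1). $v_2$ is the $2$-adic valuation. For $\alpha\in\Omega$ and a vertex $v$ at level $n$, $v$ lies in a stable cycle of $\alpha$ of length $k'$ if its $\alpha$-orbit has $k'$ elements and for every $m'>n$ all vertices at level $m'$ above this orbit form a single $\alpha$-cycle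 of length $2^{m'-n}k'$. Let $s_n(\alpha)$ be the number of such vertices at level $n$. $\alpha$ is uniformly settled if there is $C>0$ such that for all $n\ge1$ at most $C$ vertices at level $n$ do not lie in a stable cycle of $\alpha$. -}

module Defs where

open import Data.Nat using (ℕ; zero; suc; _+_; _*_; _∸_; _^_; _≤_; _<_)
open import Data.Nat.Divisibility using (_∣_)
open import Data.Nat.DivMod using (_/_)
open import Data.Bool using (Bool; true; false; _xor_; if_then_else_)
open import Data.Vec using (Vec; []; _∷_; take)
open import Data.List using (List; length)
open import Data.List.Relation.Unary.All using (All)
open import Data.List.Relation.Unary.Unique.Propositional using (Unique)
open import Data.Product using (Σ; ∃; _×_)
open import Relation.Nullary using (¬_)
open import Relation.Binary.PropositionalEquality using (_≡_; _≢_)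

-- 2-adic integers, as digit sequences: m = Σ_i (m i) 2^i.

ℤ₂ : Set
ℤ₂ = ℕ → Bool

trunc : ℤ₂ → ℕ → ℕ
trunc m zero    = 0
trunc m (suc n) = trunc m n + (if m n then 2 ^ n else 0)

IsUnit : ℤ₂ → Set
IsUnit k = k 0 ≡ true

one₂ : ℤ₂
one₂ zero    = true
one₂ (suc _) = false

minusOne₂ : ℤ₂
minusOne₂ _ = true

_≈₂_ : ℤ₂ → ℤ₂ → Set
a ≈₂ b = ∀ i → a i ≡ b i

-- ℓ = (k - 1)/2 for odd k: shift the digits
half-pred : ℤ₂ → ℤ₂
half-pred k i = k (suc i)

-- ((k² - 1)/4) mod 2^j is determined by k mod 2^(j+2); this natural
-- number is congruent to (k² - 1)/4 modulo 2^j.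
qApprox : ℤ₂ → ℕ → ℕ
qApprox k j = ((trunc k (j + 2)) ^ 2 ∸ 1) / 4

-- ν = v₂((k² - 1)/4): 2^ν divides it and 2^(ν+1) does not.
V2QuarterSqMinusOne : ℤ₂ → ℕ → Set
V2QuarterSqMinusOne k ν =
  (2 ^ ν ∣ qApprox k ν) × ¬ (2 ^ (suc ν) ∣ qApprox k (suc ν))

-- Automorphisms of the binary tree, as portraits: the label τ ∈ {id,σ}
-- (false = id, true = σ) at every vertex.  α = (α₀,α₁)τ with τ = α [],
-- α_x = section α x.

Ω : Set
Ω = ∀ {n} → Vec Bool n → Bool

section : Ω → Bool → Ω
section α x w = α (x ∷ w)

act : Ω → ∀ {n} → Vec Bool n → Vec Bool n
act α []      = []
act α (x ∷ v) = (x xor α []) ∷ act (section α x) v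

idΩ : Ω
idΩ _ = false

-- product αβ : first α then β
_·_ : Ω → Ω → Ω
(α · β) v = α v xor β (act α v)

pow : Ω → ℕ → Ω
pow α zero    = idΩ
pow α (suc j) = pow α j · α

-- α^m for m ∈ ℤ₂: the label at a vertex of level n is determined by the
-- action on level n+1, where α^(m_j) stabilises once m_j ≡ m mod 2^(n+1).
powℤ₂ : Ω → ℤ₂ → Ω
powℤ₂ α m {n} v = pow α (trunc m (suc n)) v

-- standard odometer γ = (γ, id)σ
γ : Ω
γ []          = true
γ (false ∷ w) = γ w
γ (true ∷ w)  = false

-- z_k = (z_k, γ^ℓ z_k), trivial at the root, ℓ = (k-1)/2
z : ℤ₂ → Ω
z k []                = false
z k {suc n} (false ∷ w) = z k {n} w
z k {suc n} (true ∷ w)  =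
  powℤ₂ γ (half-pred k) w xor z k {n} (act (powℤ₂ γ (half-pred k)) w)

iter : Ω → ℕ → ∀ {n} → Vec Bool n → Vec Bool n
iter α zero    v = v
iter α (suc p) v = act α (iter α p v)

OrbitSize : Ω → ∀ {n} → Vec Bool n → ℕ → Set
OrbitSize α v c =
  (0 < c) × (iter α c v ≡ v) × (∀ p → 0 < p → p < c → iter α p v ≢ v)

InOrbit : Ω → ∀ {n} → Vec Bool n → Vec Bool n → Set
InOrbit α v u = ∃ λ p → iter α p v ≡ u

Above : Ω → ∀ {n} d → Vec Bool n → Vec Bool (n + d) → Set
Above α {n} d v w = InOrbit α v (take n w)

StableCycle : Ω → ∀ {n} → Vec Bool n → ℕ → Set
StableCycle α {n} v k' =
  OrbitSize α v k' ×
  (∀ d → 1 ≤ d →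
     (∀ (w w' : Vec Bool (n + d)) → Above α d v w → Above α d v w' →
        InOrbit α w w') ×
     (∀ (w : Vec Bool (n + d)) → Above α d v w → OrbitSize α w (2 ^ d * k')))

InStableCycle : Ω → ∀ {n} → Vec Bool n → Set
InStableCycle α v = ∃ λ k' → StableCycle α v k'

AtMostUnstable : Ω → ℕ → ℕ → Set
AtMostUnstable α C n =
  (L : List (Vec Bool n)) → Unique L → All (λ v → ¬ InStableCycle α v) L →
  length L ≤ C

UniformlySettled : Ω → Set
UniformlySettled α = ∃ λ C → (1 ≤ C) × (∀ n → 1 ≤ n → AtMostUnstable α C n)

-- Encode a vertex v of level n by the integer code v < 2^n whose binary digits are its letters.
-- Then γ acts as x ↦ x - 1 and z_k as multiplication by k⁻¹ modulo 2^n, so α = γ^m z_k is the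
-- affine map x ↦ k⁻¹(x - m), and E(x) = (k - 1)x + m conjugates it to multiplication by k⁻¹
-- modulo 2^(n+s), where s = v₂(k - 1).  Let c be the order of k modulo 4 and s₀ = v₂(k^c - 1).
-- If r = v₂(E(code v)) satisfies r + s₀ ≤ n + s, the orbit of v has length c 2^(n+s-s₀-r), every
-- vertex above it has the same valuation r, and the powers of k^c, which are dense in 1 + 2^s₀ ℤ₂,
-- join all those vertices into one cycle: v lies in a stable cycle.  The other vertices of level n
-- have E(code v) ≡ 0 modulo 2^(n+1-s₀+s), which fixes code v modulo 2^(n+1-s₀); so there are at
-- most 2^(s₀-1) ≤ 2^(ν+1) of them.  All of this is run with the truncations of k and m at a
-- sufficiently high precision in place of the 2-adic integers themselves.

module Submission where

open import Data.Nat as ℕ using (ℕ; zero; suc; _≤_; _<_; z≤n; s≤s)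
import Data.Nat.Properties as ℕₚ
import Data.Nat.Divisibility as ℕ∣
open import Data.Nat.DivMod using (m*n/n≡m)
import Data.Nat.Tactic.RingSolver as ℕ-Solver
open import Data.Integer as ℤ using (ℤ; +_; 0ℤ; 1ℤ; _+_; _*_; _-_; -_; _^_)
import Data.Integer.Properties as ℤₚ
open import Data.Integer.DivMod using (_%ℕ_; _/ℕ_; a≡a%ℕn+[a/ℕn]*n; n%ℕd<d)
open import Data.Integer.Divisibility.Signed
open import Data.Integer.Tactic.RingSolver using (solve-∀)
open import Data.Bool using (Bool; true; false; _xor_; if_then_else_)
import Data.Bool.Properties as Boolₚ
open import Data.Vec using (Vec; []; _∷_; _∷ʳ_; take)
import Data.Vec.Properties as Vecₚ
open import Data.List using (List; []; _∷_; length; map; filter)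
import Data.List.Properties as Listₚ
open import Data.List.Relation.Unary.All as All using (All; []; _∷_)
import Data.List.Relation.Unary.All.Properties as Allₚ
open import Data.List.Relation.Unary.AllPairs using ([]; _∷_)
open import Data.List.Relation.Unary.Unique.Propositional using (Unique)
import Data.List.Relation.Unary.Unique.Propositional.Properties as Uniqueₚ
open import Data.Product using (∃-syntax; _×_; _,_; proj₁; proj₂)
open import Data.Sum using (_⊎_; inj₁; inj₂)
open import Data.Unit using (⊤; tt)
open import Data.Empty using (⊥-elim)
open import Function using (_∘_)
open import Relation.Nullary using (¬_; ¬?; yes; no)
open import Relation.Nullary.Decidable using (decidable-stable)
open import Relation.Binary.Definitions using (tri<; tri≈; tri>)
open import Relation.Binary.PropositionalEquality hiding (J)
open import Defs


2ℤ : ℤ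
2ℤ = + 2

pos-2^ : ∀ a → + (2 ℕ.^ a) ≡ 2ℤ ^ a
pos-2^ zero    = refl
pos-2^ (suc a) = trans (ℤₚ.pos-* 2 (2 ℕ.^ a)) (cong (2ℤ *_) (pos-2^ a))

infix 4 _≡_[mod2^_]
_≡_[mod2^_] : ℤ → ℤ → ℕ → Set
x ≡ y [mod2^ a ] = 2ℤ ^ a ∣ x - y

2^-nonZero : ∀ a → ℤ.NonZero (2ℤ ^ a)
2^-nonZero zero    = _
2^-nonZero (suc a) = ℤₚ.i*j≢0 2ℤ (2ℤ ^ a) {{_}} {{2^-nonZero a}}

1∣ : ∀ x → 1ℤ ∣ x
1∣ x = divides x (sym (ℤₚ.*-identityʳ x))

2^-mono-∣ : ∀ {a b} → a ≤ b → 2ℤ ^ a ∣ 2ℤ ^ b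
2^-mono-∣ {a} {b} a≤b = divides (2ℤ ^ (b ℕ.∸ a)) (begin
  2ℤ ^ b                      ≡⟨ cong (2ℤ ^_) (ℕₚ.m∸n+n≡m a≤b) ⟨
  2ℤ ^ (b ℕ.∸ a ℕ.+ a)        ≡⟨ ℤₚ.^-distribˡ-+-* 2ℤ (b ℕ.∸ a) a ⟩
  2ℤ ^ (b ℕ.∸ a) * 2ℤ ^ a     ∎)
  where open ≡-Reasoning

2^-weaken-∣ : ∀ {a b x} → a ≤ b → 2ℤ ^ b ∣ x → 2ℤ ^ a ∣ x
2^-weaken-∣ a≤b = ∣-trans (2^-mono-∣ a≤b)

2^-cancelˡ-∣ : ∀ r b {y} → 2ℤ ^ (r ℕ.+ b) ∣ 2ℤ ^ r * y → 2ℤ ^ b ∣ y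
2^-cancelˡ-∣ r b {y} = *-cancelˡ-∣ (2ℤ ^ r) {{2^-nonZero r}}
  ∘ subst (_∣ 2ℤ ^ r * y) (ℤₚ.^-distribˡ-+-* 2ℤ r b)

record Odd (u : ℤ) : Set where
  constructor odd
  field
    half       : ℤ
    equality   : u ≡ 1ℤ + 2ℤ * half

even-or-odd : ∀ x → 2ℤ ∣ x ⊎ Odd x
even-or-odd x with x %ℕ 2 | n%ℕd<d x 2 | a≡a%ℕn+[a/ℕn]*n x 2
... | 0 | _ | x≡ = inj₁ (divides (x /ℕ 2) (trans x≡ (ℤₚ.+-identityˡ _)))
... | 1 | _ | x≡ = inj₂ (odd (x /ℕ 2) (trans x≡ (cong (_+_ 1ℤ) (ℤₚ.*-comm (x /ℕ 2) 2ℤ))))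
... | suc (suc _) | s≤s (s≤s ()) | _

odd-* : ∀ {u v} → Odd u → Odd v → Odd (u * v)
odd-* (odd o refl) (odd p refl) = odd (o + p + 2ℤ * o * p) (lemma o p)
  where
  lemma : ∀ o p → (1ℤ + 2ℤ * o) * (1ℤ + 2ℤ * p) ≡ 1ℤ + 2ℤ * (o + p + 2ℤ * o * p)
  lemma = solve-∀

odd-^ : ∀ {u} n → Odd u → Odd (u ^ n)
odd-^ zero    _   = odd 0ℤ refl
odd-^ (suc n) u-odd = odd-* u-odd (odd-^ n u-odd)

odd⇒2∤ : ∀ {u} → Odd u → ¬ 2ℤ ∣ u
odd⇒2∤ (odd o refl) 2∣u with ℕ∣.∣1⇒≡1 (∣⇒∣ᵤ (∣m+n∣n⇒∣m {m = 1ℤ} 2∣u (∣m⇒∣m*n o ∣-refl)))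
... | ()

odd-cancelˡ-∣ : ∀ a {u x} → Odd u → 2ℤ ^ a ∣ u * x → 2ℤ ^ a ∣ x
odd-cancelˡ-∣ zero    {x = x} _ _ = 1∣ x
odd-cancelˡ-∣ (suc a) {u} {x} u-odd 2^a+1∣ux with even-or-odd x
... | inj₂ odd-x = ⊥-elim (odd⇒2∤ (odd-* u-odd odd-x) (2^-weaken-∣ {1} {suc a} (s≤s z≤n) 2^a+1∣ux))
... | inj₁ (divides y refl) = subst (2ℤ ^ suc a ∣_) (ℤₚ.*-comm 2ℤ y)
        (*-monoʳ-∣ 2ℤ (odd-cancelˡ-∣ a u-odd (*-cancelˡ-∣ 2ℤ (subst (2ℤ ^ suc a ∣_) (lemma u y) 2^a+1∣ux))))
  where
  lemma : ∀ u y → u * (y * 2ℤ) ≡ 2ℤ * (u * y)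
  lemma = solve-∀


infix 4 2^_∥_
record 2^_∥_ (a : ℕ) (x : ℤ) : Set where
  constructor exact
  field
    half-odd-part : ℤ
    equality      : x ≡ 2ℤ ^ a * (1ℤ + 2ℤ * half-odd-part)

∥⇒∣ : ∀ {a x} → 2^ a ∥ x → 2ℤ ^ a ∣ x
∥⇒∣ {a} (exact o refl) = divides (1ℤ + 2ℤ * o) (ℤₚ.*-comm (2ℤ ^ a) _)

∥⇒∤ : ∀ {a x} → 2^ a ∥ x → ¬ 2ℤ ^ suc a ∣ x
∥⇒∤ {a} (exact o refl) 2^a+1∣x = odd⇒2∤ (odd o refl)
  (*-cancelˡ-∣ (2ℤ ^ a) {{2^-nonZero a}} (subst (_∣ 2ℤ ^ a * (1ℤ + 2ℤ * o)) (ℤₚ.*-comm 2ℤ (2ℤ ^ a)) 2^a+1∣x))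

∣∧∤⇒∥ : ∀ {a x} → 2ℤ ^ a ∣ x → ¬ 2ℤ ^ suc a ∣ x → 2^ a ∥ x
∣∧∤⇒∥ {a} (divides q refl) 2^a+1∤x with even-or-odd q
... | inj₂ (odd o refl) = exact o (ℤₚ.*-comm _ (2ℤ ^ a))
... | inj₁ (divides r refl) = ⊥-elim (2^a+1∤x (divides r (lemma r (2ℤ ^ a))))
  where
  lemma : ∀ r p → r * 2ℤ * p ≡ r * (2ℤ * p)
  lemma = solve-∀

∥-≤ : ∀ {a b x} → 2^ a ∥ x → 2ℤ ^ b ∣ x → b ≤ a
∥-≤ {a} {b} a∥x 2^b∣x with b ℕ.≤? a
... | yes b≤a = b≤a
... | no b≰a = ⊥-elim (∥⇒∤ a∥x (2^-weaken-∣ (ℕₚ.≰⇒> b≰a) 2^b∣x))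

odd-cancel-∥ : ∀ {a u x} → Odd u → 2^ a ∥ u * x → 2^ a ∥ x
odd-cancel-∥ {a} {u} u-odd a∥ux =
  ∣∧∤⇒∥ (odd-cancelˡ-∣ a u-odd (∥⇒∣ a∥ux)) (λ 2^a+1∣x → ∥⇒∤ a∥ux (∣n⇒∣m*n u 2^a+1∣x))

∥-+-∣ : ∀ {a x y} → 2^ a ∥ x → 2ℤ ^ suc a ∣ y → 2^ a ∥ x + y
∥-+-∣ {a} {x} {y} a∥x 2^a+1∣y =
  ∣∧∤⇒∥ (∣m∣n⇒∣m+n (∥⇒∣ a∥x) (2^-weaken-∣ (ℕₚ.n≤1+n a) 2^a+1∣y))
        (λ 2^a+1∣x+y → ∥⇒∤ a∥x (∣m+n∣n⇒∣m 2^a+1∣x+y 2^a+1∣y))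

∥-resp-mod : ∀ {a N x y} → a < N → x ≡ y [mod2^ N ] → 2^ a ∥ x → 2^ a ∥ y
∥-resp-mod {a} {N} {x} {y} a<N 2^N∣x-y a∥x = subst (2^ a ∥_) (lemma x y)
  (∥-+-∣ a∥x (∣m⇒∣-m (2^-weaken-∣ a<N 2^N∣x-y)))
  where
  lemma : ∀ x y → x + - (x - y) ≡ y
  lemma = solve-∀

∥-* : ∀ {a b x y} → 2^ a ∥ x → 2^ b ∥ y → 2^ (a ℕ.+ b) ∥ x * y
∥-* {a} {b} (exact o refl) (exact p refl) with odd-* (odd o refl) (odd p refl)
... | odd w uv≡ = exact w (begin
  2ℤ ^ a * (1ℤ + 2ℤ * o) * (2ℤ ^ b * (1ℤ + 2ℤ * p))   ≡⟨ lemma (2ℤ ^ a) (2ℤ ^ b) _ _ ⟩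
  2ℤ ^ a * 2ℤ ^ b * ((1ℤ + 2ℤ * o) * (1ℤ + 2ℤ * p))   ≡⟨ cong₂ _*_ (sym (ℤₚ.^-distribˡ-+-* 2ℤ a b)) uv≡ ⟩
  2ℤ ^ (a ℕ.+ b) * (1ℤ + 2ℤ * w)                      ∎)
  where
  open ≡-Reasoning
  lemma : ∀ p q u v → p * u * (q * v) ≡ p * q * (u * v)
  lemma = solve-∀

∥-2* : ∀ {a x} → 2^ a ∥ x → 2^ suc a ∥ 2ℤ * x
∥-2* {a} (exact o refl) = exact o (sym (ℤₚ.*-assoc 2ℤ (2ℤ ^ a) _))

∤⇒∃∥ : ∀ N {x} → ¬ 2ℤ ^ N ∣ x → ∃[ r ] r < N × 2^ r ∥ x
∤⇒∃∥ zero    {x} 1∤x = ⊥-elim (1∤x (1∣ x))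
∤⇒∃∥ (suc N) {x} 2^N+1∤x with even-or-odd x
... | inj₂ (odd o refl) = 0 , s≤s z≤n , exact o (sym (ℤₚ.*-identityˡ _))
... | inj₁ (divides y refl)
  with ∤⇒∃∥ N {y} (λ 2^N∣y → 2^N+1∤x (subst (2ℤ ^ suc N ∣_) (ℤₚ.*-comm 2ℤ y) (*-monoʳ-∣ 2ℤ 2^N∣y)))
...   | r , r<N , r∥y = suc r , s≤s r<N , subst (2^ suc r ∥_) (ℤₚ.*-comm 2ℤ y) (∥-2* r∥y)

≡-mod-sym : ∀ {a} x y → x ≡ y [mod2^ a ] → y ≡ x [mod2^ a ]
≡-mod-sym {a} x y x≡y = subst (2ℤ ^ a ∣_) (lemma x y) (∣m⇒∣-m x≡y)
  where
  lemma : ∀ x y → - (x - y) ≡ y - x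
  lemma = solve-∀

≡-mod-trans : ∀ {a} x y z → x ≡ y [mod2^ a ] → y ≡ z [mod2^ a ] → x ≡ z [mod2^ a ]
≡-mod-trans {a} x y z x≡y y≡z = subst (2ℤ ^ a ∣_) (lemma x y z) (∣m∣n⇒∣m+n x≡y y≡z)
  where
  lemma : ∀ x y z → x - y + (y - z) ≡ x - z
  lemma = solve-∀

2^-*-∣ : ∀ a b {x y} → 2ℤ ^ a ∣ x → 2ℤ ^ b ∣ y → 2ℤ ^ (a ℕ.+ b) ∣ x * y
2^-*-∣ a b {x} {y} 2^a∣x 2^b∣y = subst (_∣ x * y) (sym (ℤₚ.^-distribˡ-+-* 2ℤ a b))
  (∣-trans (*-monoʳ-∣ (2ℤ ^ a) 2^b∣y) (*-monoˡ-∣ y 2^a∣x))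

∥-*-cong : ∀ {s c} L x y → 2^ s ∥ c → x ≡ y [mod2^ L ] → c * x ≡ c * y [mod2^ L ℕ.+ s ]
∥-*-cong {s} {c} L x y s∥c x≡y = subst (2ℤ ^ (L ℕ.+ s) ∣_) (lemma c x y) (2^-*-∣ L s x≡y (∥⇒∣ s∥c))
  where
  lemma : ∀ c x y → (x - y) * c ≡ c * x - c * y
  lemma = solve-∀

*-distribˡ-- : ∀ c x y → c * x - c * y ≡ c * (x - y)
*-distribˡ-- = solve-∀

∥-cancel-∣ : ∀ {r x} b y → 2^ r ∥ x → 2ℤ ^ (r ℕ.+ b) ∣ x * y → 2ℤ ^ b ∣ y
∥-cancel-∣ {r} b y (exact o refl) 2^r+b∣xy = odd-cancelˡ-∣ b (odd o refl)
  (2^-cancelˡ-∣ r b (subst (2ℤ ^ (r ℕ.+ b) ∣_) (ℤₚ.*-assoc (2ℤ ^ r) _ y) 2^r+b∣xy))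

∥-*-cancel : ∀ {s c} L x y → 2^ s ∥ c → c * x ≡ c * y [mod2^ L ℕ.+ s ] → x ≡ y [mod2^ L ]
∥-*-cancel {s} {c} L x y s∥c cx≡cy = ∥-cancel-∣ L (x - y) s∥c
  (subst₂ (λ e t → 2ℤ ^ e ∣ t) (ℕₚ.+-comm L s) (*-distribˡ-- c x y) cx≡cy)

odd-cancel-≡ : ∀ {u} a x y → Odd u → u * x ≡ u * y [mod2^ a ] → x ≡ y [mod2^ a ]
odd-cancel-≡ {u} a x y u-odd ux≡uy =
  odd-cancelˡ-∣ a u-odd (subst (2ℤ ^ a ∣_) (*-distribˡ-- u x y) ux≡uy)

2^-*-cong-≡ : ∀ r {e} x y → x ≡ y [mod2^ e ] → 2ℤ ^ r * x ≡ 2ℤ ^ r * y [mod2^ r ℕ.+ e ]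
2^-*-cong-≡ r {e} x y x≡y = subst₂ (λ d t → d ∣ t) (sym (ℤₚ.^-distribˡ-+-* 2ℤ r e)) (sym (*-distribˡ-- (2ℤ ^ r) x y))
  (*-monoʳ-∣ (2ℤ ^ r) x≡y)

2^-*-cancel-≡ : ∀ r {e} x y → 2ℤ ^ r * x ≡ 2ℤ ^ r * y [mod2^ r ℕ.+ e ] → x ≡ y [mod2^ e ]
2^-*-cancel-≡ r {e} x y 2ʳx≡2ʳy = 2^-cancelˡ-∣ r e (subst (2ℤ ^ (r ℕ.+ e) ∣_) (*-distribˡ-- (2ℤ ^ r) x y) 2ʳx≡2ʳy)

≡-mod-refl : ∀ {a} x → x ≡ x [mod2^ a ]
≡-mod-refl {a} x = divides 0ℤ (ℤₚ.+-inverseʳ x)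

^-cong-∣ : ∀ {d x y} n → d ∣ x - y → d ∣ x ^ n - y ^ n
^-cong-∣ zero _ = divides 0ℤ refl
^-cong-∣ {d} {x} {y} (suc n) d∣x-y = subst (d ∣_) (lemma x y (x ^ n) (y ^ n))
  (∣m∣n⇒∣m+n (∣n⇒∣m*n x (^-cong-∣ n d∣x-y)) (∣n⇒∣m*n (y ^ n) d∣x-y))
  where
  lemma : ∀ x y a b → x * (a - b) + b * (x - y) ≡ x * a - y * b
  lemma = solve-∀

-- x² - 1 = (x - 1)(x + 1), and v₂(x + 1) = 1 since 4 ∣ x - 1.
∥-sq : ∀ {a x} → 2 ≤ a → 2^ a ∥ x - 1ℤ → 2^ suc a ∥ x * x - 1ℤ
∥-sq {a} {x} 2≤a a∥x-1 = subst₂ 2^_∥_ (ℕₚ.+-comm a 1) (lemma x)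
  (∥-* {x = x - 1ℤ} a∥x-1 (∥-+-∣ (exact 0ℤ refl) (2^-weaken-∣ 2≤a (∥⇒∣ a∥x-1))))
  where
  lemma : ∀ x → (x - 1ℤ) * (2ℤ + (x - 1ℤ)) ≡ x * x - 1ℤ
  lemma = solve-∀

∥-^2^ : ∀ {s L} → 2 ≤ s → 2^ s ∥ L - 1ℤ → ∀ j → 2^ (s ℕ.+ j) ∥ L ^ (2 ℕ.^ j) - 1ℤ
∥-^2^ {s} {L} 2≤s s∥L-1 zero = subst₂ 2^_∥_ (sym (ℕₚ.+-identityʳ s)) (cong (_- 1ℤ) (sym (ℤₚ.^-identityʳ L))) s∥L-1
∥-^2^ {s} {L} 2≤s s∥L-1 (suc j) = subst₂ 2^_∥_ (sym (ℕₚ.+-suc s j)) (cong (_- 1ℤ) L^2^j*L^2^j)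
  (∥-sq {x = L ^ (2 ℕ.^ j)} (ℕₚ.≤-trans 2≤s (ℕₚ.m≤m+n s j)) (∥-^2^ {L = L} 2≤s s∥L-1 j))
  where
  L^2^j*L^2^j : L ^ (2 ℕ.^ j) * L ^ (2 ℕ.^ j) ≡ L ^ (2 ℕ.^ suc j)
  L^2^j*L^2^j = trans (sym (ℤₚ.^-distribˡ-+-* L (2 ℕ.^ j) (2 ℕ.^ j)))
                      (cong (L ^_) (cong (2 ℕ.^ j ℕ.+_) (sym (ℕₚ.+-identityʳ (2 ℕ.^ j)))))

odd-from-∥ : ∀ {s L} → 1 ≤ s → 2^ s ∥ L - 1ℤ → Odd L
odd-from-∥ {suc s} {L} _ (exact o L-1≡) = odd (2ℤ ^ s * (1ℤ + 2ℤ * o)) (begin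
  L                                       ≡⟨ lemma L ⟩
  1ℤ + (L - 1ℤ)                           ≡⟨ cong (_+_ 1ℤ) L-1≡ ⟩
  1ℤ + 2ℤ * 2ℤ ^ s * (1ℤ + 2ℤ * o)         ≡⟨ cong (_+_ 1ℤ) (ℤₚ.*-assoc 2ℤ (2ℤ ^ s) _) ⟩
  1ℤ + 2ℤ * (2ℤ ^ s * (1ℤ + 2ℤ * o))       ∎)
  where
  open ≡-Reasoning
  lemma : ∀ L → L ≡ 1ℤ + (L - 1ℤ)
  lemma = solve-∀

-- Each step either keeps p or multiplies L^p by L^(2^i) ≡ 1 + 2^(s+i) (mod 2^(s+i+1)), which flips the bit at 2^(s+i).
powers-cover : ∀ {s L x y} → 2 ≤ s → 2^ s ∥ L - 1ℤ → Odd x → y ≡ x [mod2^ s ] →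
               ∀ i → ∃[ p ] y ≡ L ^ p * x [mod2^ s ℕ.+ i ]
powers-cover {s} {L} {x} {y} _ _ _ 2^s∣y-x zero =
  0 , subst₂ (λ e z → 2ℤ ^ e ∣ y - z) (sym (ℕₚ.+-identityʳ s)) (sym (ℤₚ.*-identityˡ x)) 2^s∣y-x
powers-cover {s} {L} {x} {y} 2≤s s∥L-1 x-odd 2^s∣y-x (suc i)
  with powers-cover {s} {L} {x} {y} 2≤s s∥L-1 x-odd 2^s∣y-x i
... | p , divides q y-Lᵖx≡ with even-or-odd q
...   | inj₁ (divides q′ refl) = p , subst (λ e → 2ℤ ^ e ∣ y - L ^ p * x) (sym (ℕₚ.+-suc s i))
          (divides q′ (trans y-Lᵖx≡ (ℤₚ.*-assoc q′ 2ℤ _)))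
...   | inj₂ (odd q′ refl)
  with odd-* (odd-^ p (odd-from-∥ {L = L} (ℕₚ.≤-trans (s≤s z≤n) 2≤s) s∥L-1)) x-odd | ∥-^2^ {L = L} 2≤s s∥L-1 i
...   | odd u Lᵖx≡ | exact o L^2^i-1≡ = p ℕ.+ 2 ℕ.^ i ,
          subst (λ e → 2ℤ ^ e ∣ y - L ^ (p ℕ.+ 2 ℕ.^ i) * x) (sym (ℕₚ.+-suc s i))
          (divides (q′ - u - o - 2ℤ * u * o) (begin
            y - L ^ (p ℕ.+ 2 ℕ.^ i) * x
              ≡⟨ cong (λ t → y - t * x) (ℤₚ.^-distribˡ-+-* L p (2 ℕ.^ i)) ⟩
            y - L ^ p * L ^ (2 ℕ.^ i) * x
              ≡⟨ split y (L ^ p) (L ^ (2 ℕ.^ i)) x ⟩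
            (y - L ^ p * x) - L ^ p * x * (L ^ (2 ℕ.^ i) - 1ℤ)
              ≡⟨ cong₂ (λ a b → a - b) y-Lᵖx≡ (cong₂ _*_ Lᵖx≡ L^2^i-1≡) ⟩
            (1ℤ + 2ℤ * q′) * P - (1ℤ + 2ℤ * u) * (P * (1ℤ + 2ℤ * o))
              ≡⟨ collect q′ u o P ⟩
            (q′ - u - o - 2ℤ * u * o) * (2ℤ * P) ∎))
  where
  open ≡-Reasoning
  P = 2ℤ ^ (s ℕ.+ i)
  split : ∀ y a b x → y - a * b * x ≡ (y - a * x) - a * x * (b - 1ℤ)
  split = solve-∀
  collect : ∀ q u o P → (1ℤ + 2ℤ * q) * P - (1ℤ + 2ℤ * u) * (P * (1ℤ + 2ℤ * o)) ≡
                        (q - u - o - 2ℤ * u * o) * (2ℤ * P)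
  collect = solve-∀

^-shift-∣ : ∀ {d K} C q → d ∣ K ^ C - 1ℤ → d ∣ K ^ (C ℕ.+ q) - 1ℤ → d ∣ K ^ q - 1ℤ
^-shift-∣ {d} {K} C q d∣Kᶜ-1 d∣Kᶜ⁺ᵠ-1 = ∣m+n∣m⇒∣n
  (subst (d ∣_) (trans (cong (_- 1ℤ) (ℤₚ.^-distribˡ-+-* K C q)) (lemma (K ^ C) (K ^ q))) d∣Kᶜ⁺ᵠ-1)
  (∣n⇒∣m*n (K ^ q) d∣Kᶜ-1)
  where
  lemma : ∀ a b → a * b - 1ℤ ≡ b * (a - 1ℤ) + (b - 1ℤ)
  lemma = solve-∀

module _ {s K c} (2≤s : 2 ≤ s) (s∥Kᶜ-1 : 2^ s ∥ K ^ c - 1ℤ) where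

  ∥-^-*2^ : ∀ j → 2^ (s ℕ.+ j) ∥ K ^ (c ℕ.* 2 ℕ.^ j) - 1ℤ
  ∥-^-*2^ j = subst (λ t → 2^ (s ℕ.+ j) ∥ t - 1ℤ) (ℤₚ.^-*-assoc K c (2 ℕ.^ j))
    (∥-^2^ {L = K ^ c} 2≤s s∥Kᶜ-1 j)

  order-lift : (∀ p → 0 < p → p < c → ¬ 2ℤ ^ s ∣ K ^ p - 1ℤ) →
               ∀ j p → 0 < p → p < c ℕ.* 2 ℕ.^ j → ¬ 2ℤ ^ (s ℕ.+ j) ∣ K ^ p - 1ℤ
  order-lift minimal zero p 0<p p<c = subst (λ e → ¬ 2ℤ ^ e ∣ K ^ p - 1ℤ) (sym (ℕₚ.+-identityʳ s))
    (minimal p 0<p (subst (p <_) (ℕₚ.*-identityʳ c) p<c))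
  order-lift minimal (suc j) p 0<p p<2C 2^s+j+1∣Kᵖ-1 with ℕₚ.<-cmp p (c ℕ.* 2 ℕ.^ j)
  ... | tri< p<C _ _ = order-lift minimal j p 0<p p<C (2^-weaken-∣ (ℕₚ.+-monoʳ-≤ s (ℕₚ.n≤1+n j)) 2^s+j+1∣Kᵖ-1)
  ... | tri≈ _ refl _ = ∥⇒∤ (∥-^-*2^ j) (subst (λ e → 2ℤ ^ e ∣ K ^ p - 1ℤ) (ℕₚ.+-suc s j) 2^s+j+1∣Kᵖ-1)
  ... | tri> _ _ C<p = order-lift minimal j (p ℕ.∸ C) (ℕₚ.m<n⇒0<n∸m C<p) p∸C<C
      (^-shift-∣ C (p ℕ.∸ C) (∥⇒∣ (∥-^-*2^ j))
        (subst (λ t → 2ℤ ^ (s ℕ.+ j) ∣ K ^ t - 1ℤ) p≡C+[p∸C]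
          (2^-weaken-∣ (ℕₚ.+-monoʳ-≤ s (ℕₚ.n≤1+n j)) 2^s+j+1∣Kᵖ-1)))
    where
    C = c ℕ.* 2 ℕ.^ j
    p≡C+[p∸C] : p ≡ C ℕ.+ (p ℕ.∸ C)
    p≡C+[p∸C] = sym (ℕₚ.m+[n∸m]≡n (ℕₚ.<⇒≤ C<p))
    2C≡ : c ℕ.* 2 ℕ.^ suc j ≡ C ℕ.+ C
    2C≡ = double c (2 ℕ.^ j)
      where
      double : ∀ c t → c ℕ.* (2 ℕ.* t) ≡ c ℕ.* t ℕ.+ c ℕ.* t
      double = ℕ-Solver.solve-∀
    p∸C<C : p ℕ.∸ C < C
    p∸C<C = ℕₚ.+-cancelˡ-< C _ C (subst₂ _<_ p≡C+[p∸C] 2C≡ p<2C)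

  -- Hensel-type lifting: the odd parts of W and W′ are related modulo 2^(s+j), and powers of K^c fill 1 + 2^s ℤ₂.
  relation-lift : ∀ {r j W W′} → Odd K → 2^ r ∥ W → 2^ r ∥ W′ →
                  ∀ q → W ≡ K ^ q * W′ [mod2^ r ℕ.+ (s ℕ.+ j) ] →
                  ∀ d → ∃[ p ] W ≡ K ^ p * W′ [mod2^ r ℕ.+ (s ℕ.+ (j ℕ.+ d)) ]
  relation-lift {r} {j} K-odd (exact o refl) (exact o′ refl) q W≡KᵠW′ d =
    lift (powers-cover {s} {K ^ c} {K ^ q * u′} {u} 2≤s s∥Kᶜ-1 (odd-* (odd-^ q K-odd) (odd o′ refl)) u≡Kᵠu′ (j ℕ.+ d))
    where
    u u′ : ℤ
    u  = 1ℤ + 2ℤ * o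
    u′ = 1ℤ + 2ℤ * o′
    u≡Kᵠu′ : u ≡ K ^ q * u′ [mod2^ s ]
    u≡Kᵠu′ = 2^-weaken-∣ (ℕₚ.m≤m+n s j) (2^-*-cancel-≡ r u (K ^ q * u′)
      (subst (λ t → 2ℤ ^ r * u ≡ t [mod2^ r ℕ.+ (s ℕ.+ j) ]) (lemma (K ^ q) (2ℤ ^ r) u′) W≡KᵠW′))
      where
      lemma : ∀ Kᵠ P u′ → Kᵠ * (P * u′) ≡ P * (Kᵠ * u′)
      lemma = solve-∀
    lift : ∃[ p ] u ≡ (K ^ c) ^ p * (K ^ q * u′) [mod2^ s ℕ.+ (j ℕ.+ d) ] →
           ∃[ p ] 2ℤ ^ r * u ≡ K ^ p * (2ℤ ^ r * u′) [mod2^ r ℕ.+ (s ℕ.+ (j ℕ.+ d)) ]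
    lift (p , u≡Kᶜᵖ⁺ᵠu′) = c ℕ.* p ℕ.+ q ,
      subst (λ t → 2ℤ ^ r * u ≡ t [mod2^ r ℕ.+ (s ℕ.+ (j ℕ.+ d)) ]) regroup
        (2^-*-cong-≡ r u ((K ^ c) ^ p * (K ^ q * u′)) u≡Kᶜᵖ⁺ᵠu′)
      where
      open ≡-Reasoning
      lemma : ∀ P a b u → P * (a * (b * u)) ≡ a * b * (P * u)
      lemma = solve-∀
      regroup : 2ℤ ^ r * ((K ^ c) ^ p * (K ^ q * u′)) ≡ K ^ (c ℕ.* p ℕ.+ q) * (2ℤ ^ r * u′)
      regroup = begin
        2ℤ ^ r * ((K ^ c) ^ p * (K ^ q * u′))   ≡⟨ cong (λ t → 2ℤ ^ r * (t * (K ^ q * u′))) (ℤₚ.^-*-assoc K c p) ⟩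
        2ℤ ^ r * (K ^ (c ℕ.* p) * (K ^ q * u′)) ≡⟨ lemma (2ℤ ^ r) (K ^ (c ℕ.* p)) (K ^ q) u′ ⟩
        K ^ (c ℕ.* p) * K ^ q * (2ℤ ^ r * u′)   ≡⟨ cong (_* (2ℤ ^ r * u′)) (ℤₚ.^-distribˡ-+-* K (c ℕ.* p) q) ⟨
        K ^ (c ℕ.* p ℕ.+ q) * (2ℤ ^ r * u′)     ∎

-- Vertices as residues modulo 2^n, the first letter being the least significant bit

bit : Bool → ℕ
bit false = 0
bit true  = 1

enc : ∀ {n} → Vec Bool n → ℕ
enc []      = 0
enc (x ∷ v) = bit x ℕ.+ 2 ℕ.* enc v

code : ∀ {n} → Vec Bool n → ℤ
code v = + enc v

code-∷ : ∀ {n} x (v : Vec Bool n) → code (x ∷ v) ≡ + bit x + 2ℤ * code v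
code-∷ x v = trans (ℤₚ.pos-+ (bit x) _) (cong (_+_ (+ bit x)) (ℤₚ.pos-* 2 (enc v)))

code-∷-≡ : ∀ {J n} x y (v w : Vec Bool n) → code (x ∷ v) ≡ code (y ∷ w) [mod2^ suc J ] →
           x ≡ y × (code v ≡ code w [mod2^ J ])
code-∷-≡ {J} x y v w ∣diff with bit-≡ x y (∣m+n∣n⇒∣m {m = + bit x - + bit y} 2∣diff (∣m⇒∣m*n _ ∣-refl))
  where
  regroup : ∀ a b c d → a + 2ℤ * c - (b + 2ℤ * d) ≡ (a - b) + 2ℤ * (c - d)
  regroup = solve-∀
  diff≡ : code (x ∷ v) - code (y ∷ w) ≡ (+ bit x - + bit y) + 2ℤ * (code v - code w)
  diff≡ = trans (cong₂ _-_ (code-∷ x v) (code-∷ y w)) (regroup (+ bit x) (+ bit y) (code v) (code w))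
  2∣diff : 2ℤ ∣ (+ bit x - + bit y) + 2ℤ * (code v - code w)
  2∣diff = subst (2ℤ ∣_) diff≡ (2^-weaken-∣ {1} {suc J} (s≤s z≤n) ∣diff)
  bit-≡ : ∀ x y → 2ℤ ∣ + bit x - + bit y → x ≡ y
  bit-≡ false false _ = refl
  bit-≡ true  true  _ = refl
  bit-≡ false true  2∣-1 = ⊥-elim (odd⇒2∤ (odd (- 1ℤ) refl) 2∣-1)
  bit-≡ true  false 2∣1  = ⊥-elim (odd⇒2∤ (odd 0ℤ refl) 2∣1)
... | refl = refl , *-cancelˡ-∣ 2ℤ (subst (2ℤ ^ suc J ∣_)
  (trans (cong₂ _-_ (code-∷ x v) (code-∷ x w)) (cancel (+ bit x) (code v) (code w))) ∣diff)
  where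
  cancel : ∀ a c d → a + 2ℤ * c - (a + 2ℤ * d) ≡ 2ℤ * (c - d)
  cancel = solve-∀

code-injective : ∀ {n} (v w : Vec Bool n) → code v ≡ code w [mod2^ n ] → v ≡ w
code-injective []      []      _    = refl
code-injective {suc n} (x ∷ v) (y ∷ w) ∣diff with code-∷-≡ {n} x y v w ∣diff
... | refl , ∣diff′ = cong (x ∷_) (code-injective v w ∣diff′)

code-take : ∀ n {d} (w : Vec Bool (n ℕ.+ d)) → code w ≡ code (take n w) [mod2^ n ]
code-take zero    w       = 1∣ _
code-take (suc n) (x ∷ w) = subst (2ℤ ^ suc n ∣_)
  (sym (trans (cong₂ _-_ (code-∷ x w) (code-∷ x (take n w))) (lemma (+ bit x) (code w) (code (take n w)))))
  (*-monoʳ-∣ 2ℤ (code-take n w))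
  where
  lemma : ∀ a b c → a + 2ℤ * b - (a + 2ℤ * c) ≡ 2ℤ * (b - c)
  lemma = solve-∀

act-∷ʳ : ∀ (α : Ω) {n} (u : Vec Bool n) x → act α (u ∷ʳ x) ≡ act α u ∷ʳ (x xor α u)
act-∷ʳ α []      x = refl
act-∷ʳ α (y ∷ u) x = cong ((y xor α []) ∷_) (act-∷ʳ (section α y) u x)

act-cong : ∀ (α β : Ω) {n} (v : Vec Bool n) → (∀ {j} (u : Vec Bool j) → j < n → α u ≡ β u) →
           act α v ≡ act β v
act-cong α β []      _     = refl
act-cong α β (x ∷ v) α≗β = cong₂ _∷_ (cong (x xor_) (α≗β [] (s≤s z≤n)))
  (act-cong (section α x) (section β x) v (λ u j<n → α≗β (x ∷ u) (s≤s j<n)))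

act-· : ∀ (α β : Ω) {n} (v : Vec Bool n) → act (α · β) v ≡ act β (act α v)
act-· α β []      = refl
act-· α β (x ∷ v) = cong₂ _∷_ (sym (Boolₚ.xor-assoc x (α []) (β [])))
  (act-· (section α x) (section β (x xor α [])) v)

act-id : ∀ {n} (v : Vec Bool n) → act idΩ v ≡ v
act-id []      = refl
act-id (x ∷ v) = cong₂ _∷_ (Boolₚ.xor-comm x false) (act-id v)

act-pow : ∀ (α : Ω) p {n} (v : Vec Bool n) → act (pow α p) v ≡ iter α p v
act-pow α zero    v = act-id v
act-pow α (suc p) v = trans (act-· (pow α p) α v) (cong (act α) (act-pow α p v))

code-γ : ∀ {n} (v : Vec Bool n) → code (act γ v) + 1ℤ ≡ code v [mod2^ n ]
code-γ []          = 1∣ _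
code-γ {suc n} (false ∷ v) = subst (2ℤ ^ suc n ∣_) (sym (trans
    (cong₂ (λ a b → a + 1ℤ - b) (code-∷ true (act γ v)) (code-∷ false v)) (lemma (code (act γ v)) (code v))))
  (*-monoʳ-∣ 2ℤ (code-γ v))
  where
  lemma : ∀ a b → 1ℤ + 2ℤ * a + 1ℤ - (0ℤ + 2ℤ * b) ≡ 2ℤ * (a + 1ℤ - b)
  lemma = solve-∀
code-γ {suc n} (true ∷ v)  = subst (2ℤ ^ suc n ∣_) (sym (trans
    (cong₂ (λ a b → a + 1ℤ - b) (trans (cong (λ w → code (false ∷ w)) (act-id v)) (code-∷ false v)) (code-∷ true v))
    (lemma (code v))))
  (divides 0ℤ refl)
  where
  lemma : ∀ b → 0ℤ + 2ℤ * b + 1ℤ - (1ℤ + 2ℤ * b) ≡ 0ℤ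
  lemma = solve-∀

code-γ-iter : ∀ p {n} (v : Vec Bool n) → code (iter γ p v) + + p ≡ code v [mod2^ n ]
code-γ-iter zero    {n} v = subst (2ℤ ^ n ∣_) (sym (lemma (code v))) (divides 0ℤ refl)
  where
  lemma : ∀ a → a + 0ℤ - a ≡ 0ℤ
  lemma = solve-∀
code-γ-iter (suc p) {n} v = subst (2ℤ ^ n ∣_)
  (trans (lemma (code (iter γ (suc p) v)) (code (iter γ p v)) (+ p) (code v))
         (cong (λ t → code (iter γ (suc p) v) + t - code v) (sym (ℤₚ.pos-+ 1 p))))
  (∣m∣n⇒∣m+n (code-γ (iter γ p v)) (code-γ-iter p v))
  where
  lemma : ∀ a b n c → a + 1ℤ - b + (b + n - c) ≡ a + (1ℤ + n) - c
  lemma = solve-∀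

-- A label of γ^p at level j is read off from the action of γ^p on level j + 1, which only sees p mod 2^(j+1).
pow-γ-label : ∀ p q {j} (u : Vec Bool j) → + p ≡ + q [mod2^ suc j ] → pow γ p u ≡ pow γ q u
pow-γ-label p q {j} u p≡q = Vecₚ.∷ʳ-injectiveʳ (act (pow γ p) u) (act (pow γ q) u) (begin
  act (pow γ p) u ∷ʳ pow γ p u   ≡⟨ act-∷ʳ (pow γ p) u false ⟨
  act (pow γ p) (u ∷ʳ false)     ≡⟨ code-injective _ _ γᵖu≡γᵠu ⟩
  act (pow γ q) (u ∷ʳ false)     ≡⟨ act-∷ʳ (pow γ q) u false ⟩
  act (pow γ q) u ∷ʳ pow γ q u   ∎)
  where
  open ≡-Reasoning
  w = u ∷ʳ false
  regroup : ∀ a b p q c → a + p - c - (b + q - c) - (p - q) ≡ a - b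
  regroup = solve-∀
  γᵖu≡γᵠu : code (act (pow γ p) w) ≡ code (act (pow γ q) w) [mod2^ suc j ]
  γᵖu≡γᵠu = subst₂ (λ a b → 2ℤ ^ suc j ∣ code a - code b) (sym (act-pow γ p w)) (sym (act-pow γ q w))
    (subst (2ℤ ^ suc j ∣_) (regroup (code (iter γ p w)) (code (iter γ q w)) (+ p) (+ q) (code w))
      (∣m∣n⇒∣m-n (∣m∣n⇒∣m-n (code-γ-iter p w) (code-γ-iter q w)) p≡q))

trunc-≡ : ∀ (m : ℤ₂) {j L} → j ≤ L → + trunc m L ≡ + trunc m j [mod2^ j ]
trunc-≡ m {j} {zero}  z≤n = divides 0ℤ refl
trunc-≡ m {j} {suc L} j≤L with ℕₚ.m≤n⇒m<n∨m≡n j≤L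
... | inj₂ refl = subst (2ℤ ^ j ∣_) (sym (ℤₚ.+-inverseʳ (+ trunc m (suc L)))) (divides 0ℤ refl)
... | inj₁ (s≤s j≤L′) = subst (2ℤ ^ j ∣_) (sym eq) (∣m∣n⇒∣m+n (digit-∣ (m L)) (trunc-≡ m j≤L′))
  where
  digit : ℕ
  digit = if m L then 2 ℕ.^ L else 0
  digit-∣ : ∀ b → 2ℤ ^ j ∣ + (if b then 2 ℕ.^ L else 0)
  digit-∣ true  = subst (2ℤ ^ j ∣_) (sym (pos-2^ L)) (2^-mono-∣ j≤L′)
  digit-∣ false = divides 0ℤ refl
  regroup : ∀ a b c → a + b - c ≡ b + (a - c)
  regroup = solve-∀
  eq : + trunc m (suc L) - + trunc m j ≡ + digit + (+ trunc m L - + trunc m j)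
  eq = trans (cong (_- + trunc m j) (ℤₚ.pos-+ (trunc m L) digit)) (regroup (+ trunc m L) (+ digit) (+ trunc m j))

trunc-half-pred : ∀ (k : ℤ₂) L → trunc k (suc L) ≡ bit (k 0) ℕ.+ 2 ℕ.* trunc (half-pred k) L
trunc-half-pred k zero with k 0
... | true  = refl
... | false = refl
trunc-half-pred k (suc L) = begin
  trunc k (suc L) ℕ.+ digit (k (suc L)) (2 ℕ.* 2 ℕ.^ L)
    ≡⟨ cong₂ ℕ._+_ (trunc-half-pred k L) (digit-2* (k (suc L))) ⟩
  bit (k 0) ℕ.+ 2 ℕ.* trunc (half-pred k) L ℕ.+ 2 ℕ.* digit (k (suc L)) (2 ℕ.^ L)
    ≡⟨ regroup (bit (k 0)) (trunc (half-pred k) L) (digit (k (suc L)) (2 ℕ.^ L)) ⟩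
  bit (k 0) ℕ.+ 2 ℕ.* (trunc (half-pred k) L ℕ.+ digit (k (suc L)) (2 ℕ.^ L)) ∎
  where
  open ≡-Reasoning
  digit : Bool → ℕ → ℕ
  digit b n = if b then n else 0
  digit-2* : ∀ b → digit b (2 ℕ.* 2 ℕ.^ L) ≡ 2 ℕ.* digit b (2 ℕ.^ L)
  digit-2* true  = refl
  digit-2* false = refl
  regroup : ∀ a t d → a ℕ.+ 2 ℕ.* t ℕ.+ 2 ℕ.* d ≡ a ℕ.+ 2 ℕ.* (t ℕ.+ d)
  regroup = ℕ-Solver.solve-∀

act-powℤ₂-γ : ∀ (m : ℤ₂) {n} (v : Vec Bool n) → act (powℤ₂ γ m) v ≡ act (pow γ (trunc m n)) v
act-powℤ₂-γ m {n} v = act-cong (powℤ₂ γ m) (pow γ (trunc m n)) v λ {j} u j<n →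
  pow-γ-label (trunc m (suc j)) (trunc m n) u (≡-mod-sym {suc j} (+ trunc m n) (+ trunc m (suc j)) (trunc-≡ m {suc j} j<n))

code-powℤ₂-γ : ∀ (m : ℤ₂) {n} (v : Vec Bool n) → code (act (powℤ₂ γ m) v) + + trunc m n ≡ code v [mod2^ n ]
code-powℤ₂-γ m {n} v = subst (λ w → code w + + trunc m n ≡ code v [mod2^ n ])
  (sym (trans (act-powℤ₂-γ m v) (act-pow γ (trunc m n) v))) (code-γ-iter (trunc m n) v)

trunc-≡-weaken : ∀ (m : ℤ₂) {j L} K → j ≤ L → K ≡ + trunc m L [mod2^ L ] → K ≡ + trunc m j [mod2^ j ]
trunc-≡-weaken m {j} {L} K j≤L K≡m =
  ≡-mod-trans {j} K (+ trunc m L) (+ trunc m j) (2^-weaken-∣ j≤L K≡m) (trunc-≡ m j≤L)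

code-z : ∀ (k : ℤ₂) → IsUnit k → ∀ {n} K → K ≡ + trunc k n [mod2^ n ] → (v : Vec Bool n) →
         code v ≡ K * code (act (z k) v) [mod2^ n ]
code-z k k-odd K _ [] = 1∣ _
code-z k k-odd {suc n} K K≡k (false ∷ v) =
  subst (2ℤ ^ suc n ∣_) (sym (trans (cong₂ (λ a b → a - K * b) (code-∷ false v) (code-∷ false (act (z k) v)))
                                    (lemma (code v) K (code (act (z k) v)))))
    (*-monoʳ-∣ 2ℤ (code-z k k-odd K (trunc-≡-weaken k K (ℕₚ.n≤1+n n) K≡k) v))
  where
  lemma : ∀ a K b → 0ℤ + 2ℤ * a - K * (0ℤ + 2ℤ * b) ≡ 2ℤ * (a - K * b)
  lemma = solve-∀
code-z k k-odd {suc n} K K≡k (true ∷ v) = subst (2ℤ ^ suc n ∣_) (sym eq)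
  (∣m∣n⇒∣m-n (∣m∣n⇒∣m+n (∣m⇒∣-m (*-monoʳ-∣ 2ℤ γˡ)) (*-monoʳ-∣ 2ℤ IH)) K≡1+2ℓ)
  where
  ℓ = half-pred k
  v′ = act (powℤ₂ γ ℓ) v
  Y = code (act (z k) v′)
  t = + trunc ℓ n
  γˡ : code v′ + t ≡ code v [mod2^ n ]
  γˡ = code-powℤ₂-γ ℓ v
  IH : code v′ ≡ K * Y [mod2^ n ]
  IH = code-z k k-odd K (trunc-≡-weaken k K (ℕₚ.n≤1+n n) K≡k) v′
  K≡1+2ℓ : K ≡ 1ℤ + 2ℤ * t [mod2^ suc n ]
  K≡1+2ℓ = subst (λ x → K ≡ x [mod2^ suc n ])
    (trans (cong +_ (trunc-half-pred k n)) (trans (ℤₚ.pos-+ (bit (k 0)) _)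
           (cong₂ _+_ (cong (λ b → + bit b) k-odd) (ℤₚ.pos-* 2 (trunc ℓ n)))))
    K≡k
  lemma : ∀ W K Y W′ t → 1ℤ + 2ℤ * W - K * (1ℤ + 2ℤ * Y) ≡
          - (2ℤ * (W′ + t - W)) + 2ℤ * (W′ - K * Y) - (K - (1ℤ + 2ℤ * t))
  lemma = solve-∀
  eq : code (true ∷ v) - K * code (act (z k) (true ∷ v)) ≡
       - (2ℤ * (code v′ + t - code v)) + 2ℤ * (code v′ - K * Y) - (K - (1ℤ + 2ℤ * t))
  eq = trans (cong₂ (λ a b → a - K * b) (code-∷ true v)
               (trans (cong (λ w → code (true ∷ w)) (act-· (powℤ₂ γ ℓ) (z k) v)) (code-∷ true (act (z k) v′))))
             (lemma (code v) K Y (code v′) t)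

code-γᵐzₖ : ∀ (k m : ℤ₂) → IsUnit k → ∀ {n} K M → K ≡ + trunc k n [mod2^ n ] → M ≡ + trunc m n [mod2^ n ] →
            (v : Vec Bool n) → code v ≡ K * code (act (powℤ₂ γ m · z k) v) + M [mod2^ n ]
code-γᵐzₖ k m k-odd {n} K M K≡k M≡m v =
  subst (λ w → code v ≡ K * code w + M [mod2^ n ]) (sym (act-· (powℤ₂ γ m) (z k) v))
    (subst (2ℤ ^ n ∣_) (lemma (code v′) K (code (act (z k) v′)) (+ trunc m n) (code v) M)
      (∣m∣n⇒∣m-n (∣m∣n⇒∣m-n (code-z k k-odd K K≡k v′) (code-powℤ₂-γ m v)) M≡m))
  where
  v′ = act (powℤ₂ γ m) v
  lemma : ∀ V′ K Y t V M → V′ - K * Y - (V′ + t - V) - (M - t) ≡ V - (K * Y + M)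
  lemma = solve-∀

iter-+ : ∀ (α : Ω) p q {n} (v : Vec Bool n) → iter α (p ℕ.+ q) v ≡ iter α p (iter α q v)
iter-+ α zero    q v = refl
iter-+ α (suc p) q v = cong (act α) (iter-+ α p q v)

iter-periodic : ∀ (α : Ω) {C n} {v : Vec Bool n} → iter α C v ≡ v → ∀ a → iter α (a ℕ.* C) v ≡ v
iter-periodic α         αᶜv≡v zero    = refl
iter-periodic α {C} {v = v} αᶜv≡v (suc a) =
  trans (iter-+ α C (a ℕ.* C) v) (trans (cong (iter α C) (iter-periodic α αᶜv≡v a)) αᶜv≡v)

-- Going back a steps means going forward a (C - 1) steps.
periodic-reach : ∀ (α : Ω) {C n} {v x y : Vec Bool n} → 0 < C → iter α C v ≡ v →
                 ∀ a b → iter α a v ≡ x → iter α b v ≡ y → iter α (b ℕ.+ a ℕ.* (C ℕ.∸ 1)) x ≡ y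
periodic-reach α {C} {v = v} 0<C αᶜv≡v a b refl refl = begin
  iter α (b ℕ.+ a ℕ.* (C ℕ.∸ 1)) (iter α a v) ≡⟨ iter-+ α (b ℕ.+ a ℕ.* (C ℕ.∸ 1)) a v ⟨
  iter α (b ℕ.+ a ℕ.* (C ℕ.∸ 1) ℕ.+ a) v      ≡⟨ cong (λ t → iter α t v) exponent ⟩
  iter α (b ℕ.+ a ℕ.* C) v                    ≡⟨ iter-+ α b (a ℕ.* C) v ⟩
  iter α b (iter α (a ℕ.* C) v)               ≡⟨ cong (iter α b) (iter-periodic α αᶜv≡v a) ⟩
  iter α b v                                  ∎
  where
  open ≡-Reasoning
  exponent : b ℕ.+ a ℕ.* (C ℕ.∸ 1) ℕ.+ a ≡ b ℕ.+ a ℕ.* C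
  exponent = begin
    b ℕ.+ a ℕ.* (C ℕ.∸ 1) ℕ.+ a     ≡⟨ ℕₚ.+-assoc b _ a ⟩
    b ℕ.+ (a ℕ.* (C ℕ.∸ 1) ℕ.+ a)   ≡⟨ cong (b ℕ.+_) (ℕₚ.+-comm (a ℕ.* (C ℕ.∸ 1)) a) ⟩
    b ℕ.+ (a ℕ.+ a ℕ.* (C ℕ.∸ 1))   ≡⟨ cong (b ℕ.+_) (ℕₚ.*-suc a (C ℕ.∸ 1)) ⟨
    b ℕ.+ a ℕ.* suc (C ℕ.∸ 1)       ≡⟨ cong (λ t → b ℕ.+ a ℕ.* t) (ℕₚ.suc-pred C {{ℕ.>-nonZero 0<C}}) ⟩
    b ℕ.+ a ℕ.* C                   ∎

length-unique-< : ∀ N (xs : List ℕ) → Unique xs → All (_< N) xs → length xs ≤ N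
length-unique-< zero    []       _ _        = z≤n
length-unique-< zero    (_ ∷ _)  _ (() ∷ _)
length-unique-< (suc N) xs xs! xs<N+1 = ℕₚ.≤-trans (at-most-one-N xs xs!)
  (s≤s (length-unique-< N (filter ≢N? xs) (Uniqueₚ.filter⁺ ≢N? xs!)
    (All.zipWith (λ { (x<N+1 , x≢N) → ℕₚ.≤∧≢⇒< (ℕₚ.≤-pred x<N+1) x≢N })
                 (Allₚ.filter⁺ ≢N? xs<N+1 , Allₚ.all-filter ≢N? xs))))
  where
  ≢N? = λ x → ¬? (x ℕ.≟ N)
  at-most-one-N : ∀ xs → Unique xs → length xs ≤ suc (length (filter ≢N? xs))
  at-most-one-N []       _          = z≤n
  at-most-one-N (x ∷ xs) (x∉xs ∷ xs!) with x ℕ.≟ N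
  ... | yes refl = subst (λ ys → suc (length xs) ≤ suc (length ys)) (sym (Listₚ.filter-reject ≢N? (λ N≢N → N≢N refl)))
                     (s≤s (ℕₚ.≤-reflexive (sym (cong length
                       (Listₚ.filter-all ≢N? (All.map (λ x≢y y≡x → x≢y (sym y≡x)) x∉xs))))))
  ... | no  x≢N  = subst (λ ys → suc (length xs) ≤ suc (length ys)) (sym (Listₚ.filter-accept ≢N? x≢N))
                     (s≤s (at-most-one-N xs xs!))

enc-< : ∀ {n} (v : Vec Bool n) → enc v < 2 ℕ.^ n
enc-< []      = s≤s z≤n
enc-< (x ∷ v) = ℕₚ.≤-trans (s≤s (ℕₚ.+-monoˡ-≤ (2 ℕ.* enc v) (bit≤1 x)))
  (ℕₚ.≤-trans (ℕₚ.≤-reflexive (double (enc v))) (ℕₚ.*-monoʳ-≤ 2 (enc-< v)))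
  where
  double : ∀ e → suc (1 ℕ.+ 2 ℕ.* e) ≡ 2 ℕ.* suc e
  double = ℕ-Solver.solve-∀
  bit≤1 : ∀ x → bit x ≤ 1
  bit≤1 false = z≤n
  bit≤1 true  = s≤s z≤n

high : ℕ → ∀ {n} → Vec Bool n → ℕ
high zero    v       = enc v
high (suc J) []      = 0
high (suc J) (_ ∷ v) = high J v

high-< : ∀ J {n} (v : Vec Bool n) → high J v < 2 ℕ.^ (n ℕ.∸ J)
high-< zero    v       = enc-< v
high-< (suc J) []      = s≤s z≤n
high-< (suc J) (_ ∷ v) = high-< J v

high-injective : ∀ J {n} (v w : Vec Bool n) → code v ≡ code w [mod2^ J ] → high J v ≡ high J w → v ≡ w
high-injective zero {n} v w _ enc≡ = code-injective v w (subst (λ x → code v ≡ + x [mod2^ n ]) enc≡ (≡-mod-refl {n} (code v)))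
high-injective (suc J) []      []      _     _    = refl
high-injective (suc J) (x ∷ v) (y ∷ w) ∣diff high≡ with code-∷-≡ {J} x y v w ∣diff
... | refl , ∣diff′ = cong (x ∷_) (high-injective J v w ∣diff′ high≡)

count-congruent : ∀ J {n} (P : Vec Bool n → Set) → (∀ {v w} → P v → P w → code v ≡ code w [mod2^ J ]) →
                  (vs : List (Vec Bool n)) → Unique vs → All P vs → length vs ≤ 2 ℕ.^ (n ℕ.∸ J)
count-congruent J {n} P congruent vs vs! Pvs = subst (_≤ 2 ℕ.^ (n ℕ.∸ J)) (Listₚ.length-map (high J) vs)
  (length-unique-< _ (map (high J) vs) (high-unique vs vs! Pvs) (Allₚ.map⁺ (All.universal (high-< J) vs)))
  where
  high-unique : ∀ vs → Unique vs → All P vs → Unique (map (high J) vs)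
  high-unique []       _             _          = []
  high-unique (v ∷ vs) (v∉vs ∷ vs!) (Pv ∷ Pvs) =
    Allₚ.map⁺ (All.zipWith (λ { (v≢w , Pw) → v≢w ∘ high-injective J v _ (congruent Pv Pw) }) (v∉vs , Pvs))
    ∷ high-unique vs vs! Pvs

exponent-shift : ∀ {r s₀ j n s} → r ℕ.+ (s₀ ℕ.+ j) ≡ n ℕ.+ s →
                 ∀ d → r ℕ.+ (s₀ ℕ.+ (j ℕ.+ d)) ≡ n ℕ.+ d ℕ.+ s
exponent-shift {r} {s₀} {j} {n} {s} r+s₀+j≡n+s d = begin
  r ℕ.+ (s₀ ℕ.+ (j ℕ.+ d))  ≡⟨ reassoc r s₀ j d ⟩
  r ℕ.+ (s₀ ℕ.+ j) ℕ.+ d    ≡⟨ cong (ℕ._+ d) r+s₀+j≡n+s ⟩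
  n ℕ.+ s ℕ.+ d             ≡⟨ swap n s d ⟩
  n ℕ.+ d ℕ.+ s             ∎
  where
  open ≡-Reasoning
  reassoc : ∀ r s j d → r ℕ.+ (s ℕ.+ (j ℕ.+ d)) ≡ r ℕ.+ (s ℕ.+ j) ℕ.+ d
  reassoc = ℕ-Solver.solve-∀
  swap : ∀ n s d → n ℕ.+ s ℕ.+ d ≡ n ℕ.+ d ℕ.+ s
  swap = ℕ-Solver.solve-∀

-- E conjugates γ^m z_k on level L to multiplication by K⁻¹ modulo 2^(L + s).
module AffineDynamics (k m : ℤ₂) (k-odd : IsUnit k) {K M : ℤ} {s Λ : ℕ}
  (K-odd : Odd K) (s∥K-1 : 2^ s ∥ K - 1ℤ)
  (K≡k : K ≡ + trunc k Λ [mod2^ Λ ]) (M≡m : M ≡ + trunc m Λ [mod2^ Λ ]) where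

  α : Ω
  α = powℤ₂ γ m · z k

  E : ℤ → ℤ
  E x = (K - 1ℤ) * x + M

  E-cong : ∀ L x y → x ≡ y [mod2^ L ] → E x ≡ E y [mod2^ L ℕ.+ s ]
  E-cong L x y x≡y = subst (2ℤ ^ (L ℕ.+ s) ∣_) (lemma (K - 1ℤ) x y M) (∥-*-cong L x y s∥K-1 x≡y)
    where
    lemma : ∀ c x y M → c * x - c * y ≡ c * x + M - (c * y + M)
    lemma = solve-∀

  E-injective : ∀ L x y → E x ≡ E y [mod2^ L ℕ.+ s ] → x ≡ y [mod2^ L ]
  E-injective L x y Ex≡Ey = ∥-*-cancel L x y s∥K-1 (subst (2ℤ ^ (L ℕ.+ s) ∣_) (lemma (K - 1ℤ) x y M) Ex≡Ey)
    where
    lemma : ∀ c x y M → c * x + M - (c * y + M) ≡ c * x - c * y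
    lemma = solve-∀

  E-act : ∀ {L} → L ≤ Λ → (v : Vec Bool L) → E (code v) ≡ K * E (code (act α v)) [mod2^ L ℕ.+ s ]
  E-act {L} L≤Λ v = subst (2ℤ ^ (L ℕ.+ s) ∣_) (lemma K (code v) (code (act α v)) M)
    (∥-*-cong L (code v) (K * code (act α v) + M) s∥K-1
      (code-γᵐzₖ k m k-odd K M (trunc-≡-weaken k K L≤Λ K≡k) (trunc-≡-weaken m M L≤Λ M≡m) v))
    where
    lemma : ∀ K x y M → (K - 1ℤ) * x - (K - 1ℤ) * (K * y + M) ≡ (K - 1ℤ) * x + M - K * ((K - 1ℤ) * y + M)
    lemma = solve-∀

  E-iter : ∀ {L} → L ≤ Λ → (v : Vec Bool L) → ∀ p → E (code v) ≡ K ^ p * E (code (iter α p v)) [mod2^ L ℕ.+ s ]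
  E-iter {L} L≤Λ v zero = subst (2ℤ ^ (L ℕ.+ s) ∣_) (sym (lemma (E (code v)))) (divides 0ℤ refl)
    where
    lemma : ∀ a → a - 1ℤ * a ≡ 0ℤ
    lemma = solve-∀
  E-iter {L} L≤Λ v (suc p) = ≡-mod-trans {L ℕ.+ s}
    (E (code v)) (K ^ p * E (code (iter α p v))) (K ^ suc p * E (code (iter α (suc p) v))) (E-iter L≤Λ v p)
    (subst (2ℤ ^ (L ℕ.+ s) ∣_) (lemma (K ^ p) K (E (code (iter α p v))) (E (code (iter α (suc p) v))))
      (∣n⇒∣m*n (K ^ p) (E-act L≤Λ (iter α p v))))
    where
    lemma : ∀ Kᵖ K a b → Kᵖ * (a - K * b) ≡ Kᵖ * a - K * Kᵖ * b
    lemma = solve-∀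

  iter-from-E : ∀ {L} → L ≤ Λ → (w w′ : Vec Bool L) → ∀ p →
                E (code w) ≡ K ^ p * E (code w′) [mod2^ L ℕ.+ s ] → iter α p w ≡ w′
  iter-from-E {L} L≤Λ w w′ p Ew≡KᵖEw′ = code-injective (iter α p w) w′ (E-injective L _ _ Eαᵖw≡Ew′)
    where
    e = L ℕ.+ s
    KᵖEαᵖw≡KᵖEw′ : K ^ p * E (code (iter α p w)) ≡ K ^ p * E (code w′) [mod2^ e ]
    KᵖEαᵖw≡KᵖEw′ = ≡-mod-trans {e} (K ^ p * E (code (iter α p w))) (E (code w)) (K ^ p * E (code w′))
      (≡-mod-sym {e} (E (code w)) _ (E-iter L≤Λ w p)) Ew≡KᵖEw′
    Eαᵖw≡Ew′ : E (code (iter α p w)) ≡ E (code w′) [mod2^ e ]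
    Eαᵖw≡Ew′ = odd-cancel-≡ e _ _ (odd-^ p K-odd) KᵖEαᵖw≡KᵖEw′

  E-take : ∀ n {d} (w : Vec Bool (n ℕ.+ d)) → E (code (take n w)) ≡ E (code w) [mod2^ n ℕ.+ s ]
  E-take n w = E-cong n (code (take n w)) (code w) (≡-mod-sym {n} (code w) (code (take n w)) (code-take n w))

  E-above : ∀ n {d} → n ℕ.+ d ≤ Λ → (v : Vec Bool n) (w : Vec Bool (n ℕ.+ d)) → ∀ a → iter α a v ≡ take n w →
            E (code v) ≡ K ^ a * E (code w) [mod2^ n ℕ.+ s ]
  E-above n {d} n+d≤Λ v w a αᵃv≡w↾n = ≡-mod-trans {n ℕ.+ s} (E (code v)) (K ^ a * E (code (take n w))) (K ^ a * E (code w))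
    (subst (λ u → E (code v) ≡ K ^ a * E (code u) [mod2^ n ℕ.+ s ]) αᵃv≡w↾n
      (E-iter (ℕₚ.≤-trans (ℕₚ.m≤m+n n d) n+d≤Λ) v a))
    (subst (2ℤ ^ (n ℕ.+ s) ∣_) (sym (*-distribˡ-- (K ^ a) (E (code (take n w))) (E (code w))))
      (∣n⇒∣m*n (K ^ a) (E-take n w)))

  above-∥ : ∀ n {d} → n ℕ.+ d ≤ Λ → (v : Vec Bool n) → ∀ r → r < n ℕ.+ s → 2^ r ∥ E (code v) →
            (w : Vec Bool (n ℕ.+ d)) → Above α d v w → 2^ r ∥ E (code w)
  above-∥ n n+d≤Λ v r r<n+s r∥Ev w (a , αᵃv≡w↾n) =
    odd-cancel-∥ (odd-^ a K-odd) (∥-resp-mod r<n+s (E-above n n+d≤Λ v w a αᵃv≡w↾n) r∥Ev)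

  module StableCycles {c s₀ : ℕ} (0<c : 0 < c) (2≤s₀ : 2 ≤ s₀) (s₀∥Kᶜ-1 : 2^ s₀ ∥ K ^ c - 1ℤ)
    (minimal : ∀ p → 0 < p → p < c → ¬ 2ℤ ^ s₀ ∣ K ^ p - 1ℤ) where

    period : ℕ → ℕ
    period j = c ℕ.* 2 ℕ.^ j

    0<period : ∀ j → 0 < period j
    0<period j = ℕ.>-nonZero⁻¹ (period j) {{ℕₚ.m*n≢0 c (2 ℕ.^ j) {{ℕ.>-nonZero 0<c}} {{ℕₚ.m^n≢0 2 j}}}}

    valuation<level : ∀ {r j L} → r ℕ.+ (s₀ ℕ.+ j) ≡ L ℕ.+ s → r < L ℕ.+ s
    valuation<level {r} {j} r+s₀+j≡L+s = subst (r <_) r+s₀+j≡L+s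
      (ℕₚ.m<m+n r (ℕₚ.<-≤-trans (s≤s z≤n) (ℕₚ.≤-trans 2≤s₀ (ℕₚ.m≤m+n s₀ j))))

    orbit-size : ∀ {L} → L ≤ Λ → (w : Vec Bool L) → ∀ r j → r ℕ.+ (s₀ ℕ.+ j) ≡ L ℕ.+ s →
                 2^ r ∥ E (code w) → OrbitSize α w (period j)
    orbit-size {L} L≤Λ w r j r+s₀+j≡L+s r∥Ew = 0<period j , returns , minimality
      where
      Ew = E (code w)
      returns : iter α (period j) w ≡ w
      returns = iter-from-E L≤Λ w w (period j)
        (subst₂ (λ e t → 2ℤ ^ e ∣ t) (trans (ℕₚ.+-comm (s₀ ℕ.+ j) r) r+s₀+j≡L+s) (lemma (K ^ period j) Ew)
          (∣m⇒∣-m (∥⇒∣ (∥-* (∥-^-*2^ {K = K} {c} 2≤s₀ s₀∥Kᶜ-1 j) r∥Ew))))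
        where
        lemma : ∀ Kᶜ x → - ((Kᶜ - 1ℤ) * x) ≡ x - Kᶜ * x
        lemma = solve-∀
      minimality : ∀ p → 0 < p → p < period j → iter α p w ≢ w
      minimality p 0<p p<C αᵖw≡w = order-lift {K = K} {c} 2≤s₀ s₀∥Kᶜ-1 minimal j p 0<p p<C
        (∥-cancel-∣ (s₀ ℕ.+ j) (K ^ p - 1ℤ) r∥Ew
        (subst₂ (λ e t → 2ℤ ^ e ∣ t) (sym r+s₀+j≡L+s) (lemma (K ^ p) Ew)
          (∣m⇒∣-m (subst (λ u → Ew ≡ K ^ p * E (code u) [mod2^ L ℕ.+ s ]) αᵖw≡w (E-iter L≤Λ w p)))))
        where
        lemma : ∀ Kᵖ x → - (x - Kᵖ * x) ≡ x * (Kᵖ - 1ℤ)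
        lemma = solve-∀

    above-same-orbit : ∀ n {d} → n ℕ.+ d ≤ Λ → (v : Vec Bool n) → ∀ r j → r ℕ.+ (s₀ ℕ.+ j) ≡ n ℕ.+ s →
                       2^ r ∥ E (code v) → (w w′ : Vec Bool (n ℕ.+ d)) → Above α d v w → Above α d v w′ →
                       InOrbit α w w′
    above-same-orbit n {d} n+d≤Λ v r j r+s₀+j≡n+s r∥Ev w w′ (a , αᵃv≡w↾n) (a′ , αᵃ′v≡w′↾n) =
      conclude (relation-lift {K = K} {c} 2≤s₀ s₀∥Kᶜ-1 K-odd
                 (r∥ w (a , αᵃv≡w↾n)) (r∥ w′ (a′ , αᵃ′v≡w′↾n)) q
                 (subst (λ e → E (code w) ≡ K ^ q * E (code w′) [mod2^ e ]) (sym r+s₀+j≡n+s) W≡KᵠW′) d)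
      where
      n≤Λ = ℕₚ.≤-trans (ℕₚ.m≤m+n n d) n+d≤Λ
      r∥ : ∀ u → Above α d v u → 2^ r ∥ E (code u)
      r∥ = above-∥ n n+d≤Λ v r (valuation<level r+s₀+j≡n+s) r∥Ev
      C = period j
      q = a′ ℕ.+ a ℕ.* (C ℕ.∸ 1)
      w↾n→w′↾n : iter α q (take n w) ≡ take n w′
      w↾n→w′↾n = periodic-reach α (0<period j)
        (proj₁ (proj₂ (orbit-size n≤Λ v r j r+s₀+j≡n+s r∥Ev))) a a′ αᵃv≡w↾n αᵃ′v≡w′↾n
      W≡KᵠW′ : E (code w) ≡ K ^ q * E (code w′) [mod2^ n ℕ.+ s ]
      W≡KᵠW′ = ≡-mod-trans {n ℕ.+ s} (E (code w)) (E (code (take n w))) (K ^ q * E (code w′))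
        (≡-mod-sym {n ℕ.+ s} (E (code (take n w))) (E (code w)) (E-take n w))
        (E-above n n+d≤Λ (take n w) w′ q w↾n→w′↾n)
      conclude : ∃[ p ] E (code w) ≡ K ^ p * E (code w′) [mod2^ r ℕ.+ (s₀ ℕ.+ (j ℕ.+ d)) ] → InOrbit α w w′
      conclude (p , W≡KᵖW′) = p , iter-from-E n+d≤Λ w w′ p
        (subst (λ e → E (code w) ≡ K ^ p * E (code w′) [mod2^ e ])
               (exponent-shift {r} {s₀} {j} {n} {s} r+s₀+j≡n+s d) W≡KᵖW′)

-- s = v₂(k - 1), c = the order of k modulo 4 and s₀ = v₂(k^c - 1), valid for every K ≡ k (mod 2^(ν+3)).
record OrderProfile (k : ℤ₂) (ν : ℕ) : Set where
  field
    s s₀ c  : ℕ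
    1≤s     : 1 ≤ s
    s≤ν+2   : s ≤ ν ℕ.+ 2
    2≤s₀    : 2 ≤ s₀
    s₀≤ν+2  : s₀ ≤ ν ℕ.+ 2
    0<c     : 0 < c
    profile : ∀ K → K ≡ + trunc k (ν ℕ.+ 3) [mod2^ ν ℕ.+ 3 ] →
              2^ s ∥ K - 1ℤ × 2^ s₀ ∥ K ^ c - 1ℤ × (∀ p → 0 < p → p < c → ¬ 2ℤ ^ s₀ ∣ K ^ p - 1ℤ)

qApprox≡ : ∀ (k : ℤ₂) → IsUnit k → ∀ j →
           + qApprox k j ≡ + trunc (half-pred k) (suc j) * (1ℤ + + trunc (half-pred k) (suc j))
qApprox≡ k k-odd j = begin
  + ((trunc k (j ℕ.+ 2) ℕ.^ 2 ℕ.∸ 1) ℕ./ 4)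
    ≡⟨ cong (λ i → + ((trunc k i ℕ.^ 2 ℕ.∸ 1) ℕ./ 4)) (ℕₚ.+-comm j 2) ⟩
  + ((trunc k (2 ℕ.+ j) ℕ.^ 2 ℕ.∸ 1) ℕ./ 4)     ≡⟨ cong (λ x → + ((x ℕ.^ 2 ℕ.∸ 1) ℕ./ 4)) trunc-k ⟩
  + (((1 ℕ.+ 2 ℕ.* t) ℕ.^ 2 ℕ.∸ 1) ℕ./ 4)       ≡⟨ cong (λ x → + ((x ℕ.∸ 1) ℕ./ 4)) (square t) ⟩
  + ((1 ℕ.+ t ℕ.* (1 ℕ.+ t) ℕ.* 4 ℕ.∸ 1) ℕ./ 4)
    ≡⟨ cong (λ x → + (x ℕ./ 4)) (ℕₚ.m+n∸m≡n 1 (t ℕ.* (1 ℕ.+ t) ℕ.* 4)) ⟩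
  + (t ℕ.* (1 ℕ.+ t) ℕ.* 4 ℕ./ 4)               ≡⟨ cong +_ (m*n/n≡m (t ℕ.* (1 ℕ.+ t)) 4) ⟩
  + (t ℕ.* (1 ℕ.+ t))                           ≡⟨ ℤₚ.pos-* t (1 ℕ.+ t) ⟩
  + t * + (1 ℕ.+ t)                             ≡⟨ cong (+ t *_) (ℤₚ.pos-+ 1 t) ⟩
  + t * (1ℤ + + t)                              ∎
  where
  open ≡-Reasoning
  t = trunc (half-pred k) (suc j)
  trunc-k : trunc k (2 ℕ.+ j) ≡ 1 ℕ.+ 2 ℕ.* t
  trunc-k = trans (trunc-half-pred k (suc j)) (cong (λ b → bit b ℕ.+ 2 ℕ.* t) k-odd)
  square : ∀ t → (1 ℕ.+ 2 ℕ.* t) ℕ.* ((1 ℕ.+ 2 ℕ.* t) ℕ.* 1) ≡ 1 ℕ.+ t ℕ.* (1 ℕ.+ t) ℕ.* 4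
  square = ℕ-Solver.solve-∀

module _ (k : ℤ₂) (k-odd : IsUnit k) (ν : ℕ) where

  private
    T K₀ : ℤ
    T  = + trunc (half-pred k) (suc (suc ν))
    K₀ = + trunc k (ν ℕ.+ 3)

    K₀≡1+2T : K₀ ≡ 1ℤ + 2ℤ * T
    K₀≡1+2T = begin
      + trunc k (ν ℕ.+ 3)                                           ≡⟨ cong (λ i → + trunc k i) (ℕₚ.+-comm ν 3) ⟩
      + trunc k (3 ℕ.+ ν)                                           ≡⟨ cong +_ (trunc-half-pred k (suc (suc ν))) ⟩
      + (bit (k 0) ℕ.+ 2 ℕ.* trunc (half-pred k) (suc (suc ν)))     ≡⟨ ℤₚ.pos-+ (bit (k 0)) _ ⟩
      + bit (k 0) + + (2 ℕ.* trunc (half-pred k) (suc (suc ν)))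
        ≡⟨ cong₂ _+_ (cong (λ b → + bit b) k-odd) (ℤₚ.pos-* 2 (trunc (half-pred k) (suc (suc ν)))) ⟩
      1ℤ + 2ℤ * T                                                   ∎
      where open ≡-Reasoning

    K₀ᶜ-1-transfer : ∀ {a} c K → a < ν ℕ.+ 3 → K ≡ K₀ [mod2^ ν ℕ.+ 3 ] →
                     2^ a ∥ K₀ ^ c - 1ℤ → 2^ a ∥ K ^ c - 1ℤ
    K₀ᶜ-1-transfer c K a<ν+3 K≡K₀ = ∥-resp-mod a<ν+3 (subst (2ℤ ^ (ν ℕ.+ 3) ∣_) (lemma (K₀ ^ c) (K ^ c))
      (^-cong-∣ c (≡-mod-sym {ν ℕ.+ 3} K K₀ K≡K₀)))
      where
      lemma : ∀ x y → x - y ≡ x - 1ℤ - (y - 1ℤ)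
      lemma = solve-∀

    ℕ∣⇒ℤ∣ : ∀ a n → 2 ℕ.^ a ℕ∣.∣ n → 2ℤ ^ a ∣ + n
    ℕ∣⇒ℤ∣ a n 2^a∣n = subst (_∣ + n) (pos-2^ a) (∣ᵤ⇒∣ 2^a∣n)

    ℤ∣⇒ℕ∣ : ∀ a n → 2ℤ ^ a ∣ + n → 2 ℕ.^ a ℕ∣.∣ n
    ℤ∣⇒ℕ∣ a n 2^a∣n = ∣⇒∣ᵤ (subst (_∣ + n) (sym (pos-2^ a)) 2^a∣n)

  -- The hypothesis on ν is read at two precisions; T(1 + T) is the finer approximation of (k² - 1)/4.
  ν-exact : V2QuarterSqMinusOne k ν → 2^ ν ∥ T * (1ℤ + T)
  ν-exact (2^ν∣q , 2^ν+1∤q′) = ∣∧∤⇒∥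
    (subst (2ℤ ^ ν ∣_) (lemma T T′)
      (∣m∣n⇒∣m+n 2^ν∣T′[1+T′] (∣m⇒∣m*n (1ℤ + T + T′) (2^-weaken-∣ (ℕₚ.n≤1+n ν) T≡T′))))
    (λ 2^ν+1∣T[1+T] → 2^ν+1∤q′ (ℤ∣⇒ℕ∣ (suc ν) _
      (subst (2ℤ ^ suc ν ∣_) (sym (qApprox≡ k k-odd (suc ν))) 2^ν+1∣T[1+T])))
    where
    T′ = + trunc (half-pred k) (suc ν)
    T≡T′ : T ≡ T′ [mod2^ suc ν ]
    T≡T′ = trunc-≡ (half-pred k) (ℕₚ.n≤1+n (suc ν))
    2^ν∣T′[1+T′] : 2ℤ ^ ν ∣ T′ * (1ℤ + T′)
    2^ν∣T′[1+T′] = subst (2ℤ ^ ν ∣_) (qApprox≡ k k-odd ν) (ℕ∣⇒ℤ∣ ν _ 2^ν∣q)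
    lemma : ∀ a b → b * (1ℤ + b) + (a - b) * (1ℤ + a + b) ≡ a * (1ℤ + a)
    lemma = solve-∀

  order-profile : V2QuarterSqMinusOne k ν → OrderProfile k ν
  order-profile hyp = by-parity (even-or-odd T)
    where
    ν∥T[1+T] = ν-exact hyp
    K₀-1≡2T : K₀ - 1ℤ ≡ 2ℤ * T
    K₀-1≡2T = trans (cong (_- 1ℤ) K₀≡1+2T) (lemma T)
      where
      lemma : ∀ T → 1ℤ + 2ℤ * T - 1ℤ ≡ 2ℤ * T
      lemma = solve-∀
    ν+2≡ : suc (suc ν) ≡ ν ℕ.+ 2
    ν+2≡ = ℕₚ.+-comm 2 ν
    by-parity : 2ℤ ∣ T ⊎ Odd T → OrderProfile k ν
    by-parity (inj₁ 2∣T) = record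
      { s = suc ν ; s₀ = suc ν ; c = 1
      ; 1≤s = s≤s z≤n ; s≤ν+2 = ν+1≤ν+2
      ; 2≤s₀ = s≤s (∥-≤ ν∥T 2∣T) ; s₀≤ν+2 = ν+1≤ν+2 ; 0<c = s≤s z≤n
      ; profile = λ K K≡K₀ → let ν+1∥Kᶜ-1 = K₀ᶜ-1-transfer 1 K ν+1<ν+3 K≡K₀ ν+1∥K₀¹-1 in
          subst (λ x → 2^ suc ν ∥ x - 1ℤ) (ℤₚ.^-identityʳ K) ν+1∥Kᶜ-1 , ν+1∥Kᶜ-1 ,
          λ { p 0<p (s≤s p≤0) _ → ℕₚ.<⇒≢ 0<p (sym (ℕₚ.n≤0⇒n≡0 p≤0)) } }
      where
      ν∥T : 2^ ν ∥ T
      ν∥T = odd-cancel-∥ 1+T-odd (subst (2^ ν ∥_) (ℤₚ.*-comm T (1ℤ + T)) ν∥T[1+T])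
        where
        1+T-odd : Odd (1ℤ + T)
        1+T-odd = odd (quotient 2∣T) (cong (_+_ 1ℤ) (trans (_∣_.equality 2∣T) (ℤₚ.*-comm (quotient 2∣T) 2ℤ)))
      ν+1≤ν+2 = subst (suc ν ≤_) ν+2≡ (ℕₚ.n≤1+n (suc ν))
      ν+1<ν+3 = subst (suc ν <_) (ℕₚ.+-comm 3 ν) (ℕₚ.n≤1+n _)
      ν+1∥K₀¹-1 : 2^ suc ν ∥ K₀ ^ 1 - 1ℤ
      ν+1∥K₀¹-1 = subst (λ x → 2^ suc ν ∥ x - 1ℤ) (sym (ℤₚ.^-identityʳ K₀))
        (subst (2^ suc ν ∥_) (sym K₀-1≡2T) (∥-2* ν∥T))
    by-parity (inj₂ (odd o T≡1+2o)) = record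
      { s = 1 ; s₀ = suc (suc ν) ; c = 2
      ; 1≤s = s≤s z≤n ; s≤ν+2 = ℕₚ.≤-trans (s≤s z≤n) (ℕₚ.m≤n+m 2 ν)
      ; 2≤s₀ = s≤s (s≤s z≤n) ; s₀≤ν+2 = ℕₚ.≤-reflexive ν+2≡ ; 0<c = s≤s z≤n
      ; profile = λ K K≡K₀ → let 1∥K-1 = subst (λ x → 2^ 1 ∥ x - 1ℤ) (ℤₚ.^-identityʳ K)
                                         (K₀ᶜ-1-transfer 1 K 1<ν+3 K≡K₀ 1∥K₀¹-1) in
          1∥K-1 , K₀ᶜ-1-transfer 2 K ν+2<ν+3 K≡K₀ ν+2∥K₀²-1 , minimal K 1∥K-1 }
      where
      1<ν+3 = ℕₚ.≤-trans (s≤s (s≤s z≤n)) (ℕₚ.m≤n+m 3 ν)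
      ν+2<ν+3 = ℕₚ.≤-reflexive (ℕₚ.+-comm 3 ν)
      1∥K₀¹-1 : 2^ 1 ∥ K₀ ^ 1 - 1ℤ
      1∥K₀¹-1 = exact o (trans (cong (_- 1ℤ) (ℤₚ.^-identityʳ K₀)) (trans K₀-1≡2T (cong (2ℤ *_) T≡1+2o)))
      ν+2∥K₀²-1 : 2^ suc (suc ν) ∥ K₀ ^ 2 - 1ℤ
      ν+2∥K₀²-1 = subst (2^ suc (suc ν) ∥_) (sym (trans (cong (λ x → x ^ 2 - 1ℤ) K₀≡1+2T) (lemma T)))
        (∥-2* (∥-2* ν∥T[1+T]))
        where
        lemma : ∀ T → (1ℤ + 2ℤ * T) * ((1ℤ + 2ℤ * T) * 1ℤ) - 1ℤ ≡ 2ℤ * (2ℤ * (T * (1ℤ + T)))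
        lemma = solve-∀
      minimal : ∀ K → 2^ 1 ∥ K - 1ℤ → ∀ p → 0 < p → p < 2 → ¬ 2ℤ ^ suc (suc ν) ∣ K ^ p - 1ℤ
      minimal K 1∥K-1 1 _ _ 2^ν+2∣K¹-1 =
        ∥⇒∤ 1∥K-1 (2^-weaken-∣ {2} {suc (suc ν)} (s≤s (s≤s z≤n))
          (subst (λ x → 2ℤ ^ suc (suc ν) ∣ x - 1ℤ) (ℤₚ.^-identityʳ K) 2^ν+2∣K¹-1))
      minimal K _ (suc (suc p)) _ (s≤s (s≤s ()))

module _ (k m : ℤ₂) (k-odd : IsUnit k) (ν : ℕ) (hyp : V2QuarterSqMinusOne k ν) where

  open OrderProfile (order-profile k k-odd ν hyp)

  α : Ω
  α = powℤ₂ γ m · z k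

  module AtLevel (n d : ℕ) where
    Λ : ℕ
    Λ = n ℕ.+ d ℕ.+ (ν ℕ.+ 3)

    K M : ℤ
    K = + trunc k Λ
    M = + trunc m Λ

    private
      K-profile = profile K (trunc-≡ k (ℕₚ.m≤n+m (ν ℕ.+ 3) (n ℕ.+ d)))

    n+d≤Λ : n ℕ.+ d ≤ Λ
    n+d≤Λ = ℕₚ.m≤m+n (n ℕ.+ d) (ν ℕ.+ 3)

    open AffineDynamics k m k-odd {K} {M} {s} {Λ} (odd-from-∥ 1≤s (proj₁ K-profile)) (proj₁ K-profile)
      (≡-mod-refl {Λ} K) (≡-mod-refl {Λ} M) public
    open StableCycles 0<c 2≤s₀ (proj₁ (proj₂ K-profile)) (proj₂ (proj₂ K-profile)) public

  E₀ : ∀ n → ℤ → ℤ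
  E₀ n = AtLevel.E n 0

  E₀-∥-lift : ∀ n d {r x} → r < n ℕ.+ s → 2^ r ∥ E₀ n x → 2^ r ∥ AtLevel.E n d x
  E₀-∥-lift n d {r} {x} r<n+s = ∥-resp-mod r<Λ₀ (subst (2ℤ ^ Λ₀ ∣_) (lemma K₀ K M₀ M x)
    (∣m⇒∣-m (∣m∣n⇒∣m+n (∣m⇒∣m*n x (trunc-≡ k Λ₀≤Λ)) (trunc-≡ m Λ₀≤Λ))))
    where
    open AtLevel n d
    open AtLevel n 0 using () renaming (Λ to Λ₀; K to K₀; M to M₀)
    Λ₀≤Λ : Λ₀ ≤ Λ
    Λ₀≤Λ = ℕₚ.+-monoˡ-≤ (ν ℕ.+ 3) (ℕₚ.+-monoʳ-≤ n z≤n)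
    r<Λ₀ : r < Λ₀
    r<Λ₀ = ℕₚ.<-≤-trans r<n+s (ℕₚ.+-mono-≤ (ℕₚ.≤-reflexive (sym (ℕₚ.+-identityʳ n)))
      (ℕₚ.≤-trans s≤ν+2 (ℕₚ.+-monoʳ-≤ ν (ℕₚ.n≤1+n 2))))
    lemma : ∀ K₀ K M₀ M x → - ((K - K₀) * x + (M - M₀)) ≡ (K₀ - 1ℤ) * x + M₀ - ((K - 1ℤ) * x + M)
    lemma = solve-∀

  in-stable-cycle : ∀ n (v : Vec Bool n) r j → r ℕ.+ (s₀ ℕ.+ j) ≡ n ℕ.+ s → 2^ r ∥ E₀ n (code v) →
                    InStableCycle α v
  in-stable-cycle n v r j r+s₀+j≡n+s r∥Ev =
    period j , orbit-size n≤Λ₀ v r j r+s₀+j≡n+s r∥Ev , λ d _ → same-orbit d , orbit-above d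
    where
    open AtLevel n 0 using (period; orbit-size) renaming (n+d≤Λ to n+0≤Λ₀)
    n≤Λ₀ = ℕₚ.≤-trans (ℕₚ.m≤m+n n 0) n+0≤Λ₀
    r∥E : ∀ d → 2^ r ∥ AtLevel.E n d (code v)
    r∥E d = E₀-∥-lift n d (AtLevel.valuation<level n 0 r+s₀+j≡n+s) r∥Ev
    same-orbit : ∀ d (w w′ : Vec Bool (n ℕ.+ d)) → Above α d v w → Above α d v w′ → InOrbit α w w′
    same-orbit d = AtLevel.above-same-orbit n d n (AtLevel.n+d≤Λ n d) v r j r+s₀+j≡n+s (r∥E d)
    orbit-above : ∀ d (w : Vec Bool (n ℕ.+ d)) → Above α d v w → OrbitSize α w (2 ℕ.^ d ℕ.* period j)
    orbit-above d w w-above = subst (OrbitSize α w) (period-shift c j d)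
      (AtLevel.orbit-size n d (AtLevel.n+d≤Λ n d) w r (j ℕ.+ d) (exponent-shift {r} {s₀} {j} {n} {s} r+s₀+j≡n+s d)
        (AtLevel.above-∥ n d n (AtLevel.n+d≤Λ n d) v r (AtLevel.valuation<level n d r+s₀+j≡n+s) (r∥E d) w w-above))
      where
      period-shift : ∀ c j d → c ℕ.* 2 ℕ.^ (j ℕ.+ d) ≡ 2 ℕ.^ d ℕ.* (c ℕ.* 2 ℕ.^ j)
      period-shift c j d = trans (cong (c ℕ.*_) (ℕₚ.^-distribˡ-+-* 2 j d)) (lemma c (2 ℕ.^ j) (2 ℕ.^ d))
        where
        lemma : ∀ c a b → c ℕ.* (a ℕ.* b) ≡ b ℕ.* (c ℕ.* a)
        lemma = ℕ-Solver.solve-∀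

  -- Below valuation J + s every vertex is stable, so the unstable vertices agree modulo 2^J.
  module Unstable (n : ℕ) (s₀≤n+1 : s₀ ≤ suc n) where
    J : ℕ
    J = suc n ℕ.∸ s₀

    unstable-∣ : (v : Vec Bool n) → ¬ InStableCycle α v → 2ℤ ^ (J ℕ.+ s) ∣ E₀ n (code v)
    unstable-∣ v unstable = decidable-stable (2ℤ ^ (J ℕ.+ s) ∣? E₀ n (code v)) λ 2^J+s∤E →
      let (r , r<J+s , r∥E) = ∤⇒∃∥ (J ℕ.+ s) 2^J+s∤E in
      unstable (in-stable-cycle n v r (J ℕ.+ s ℕ.∸ suc r) (exponent r<J+s) r∥E)
      where
      exponent : ∀ {r} → r < J ℕ.+ s → r ℕ.+ (s₀ ℕ.+ (J ℕ.+ s ℕ.∸ suc r)) ≡ n ℕ.+ s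
      exponent {r} r<J+s = ℕₚ.suc-injective (begin
        suc (r ℕ.+ (s₀ ℕ.+ j))   ≡⟨ lemma r s₀ j ⟩
        s₀ ℕ.+ (suc r ℕ.+ j)     ≡⟨ cong (s₀ ℕ.+_) (ℕₚ.m+[n∸m]≡n r<J+s) ⟩
        s₀ ℕ.+ (J ℕ.+ s)         ≡⟨ ℕₚ.+-assoc s₀ J s ⟨
        s₀ ℕ.+ J ℕ.+ s           ≡⟨ cong (ℕ._+ s) (ℕₚ.m+[n∸m]≡n s₀≤n+1) ⟩
        suc n ℕ.+ s              ∎)
        where
        open ≡-Reasoning
        j = J ℕ.+ s ℕ.∸ suc r
        lemma : ∀ r s₀ j → suc (r ℕ.+ (s₀ ℕ.+ j)) ≡ s₀ ℕ.+ (suc r ℕ.+ j)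
        lemma = ℕ-Solver.solve-∀

    unstable-congruent : ∀ {v w : Vec Bool n} → 2ℤ ^ (J ℕ.+ s) ∣ E₀ n (code v) → 2ℤ ^ (J ℕ.+ s) ∣ E₀ n (code w) →
                         code v ≡ code w [mod2^ J ]
    unstable-congruent {v} {w} 2^J+s∣Ev 2^J+s∣Ew =
      AtLevel.E-injective n 0 J (code v) (code w) (∣m∣n⇒∣m-n 2^J+s∣Ev 2^J+s∣Ew)

  at-most-unstable-deep : ∀ n → suc ν ≤ n → AtMostUnstable α (2 ℕ.^ suc ν) n
  at-most-unstable-deep n ν<n vs vs! unstable = ℕₚ.≤-trans
    (count-congruent J (λ v → 2ℤ ^ (J ℕ.+ s) ∣ E₀ n (code v)) (λ {v} {w} → unstable-congruent {v} {w}) vs vs!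
      (All.map (unstable-∣ _) unstable))
    (ℕₚ.^-monoʳ-≤ 2 n∸J≤ν+1)
    where
    s₀≤n+1 : s₀ ≤ suc n
    s₀≤n+1 = ℕₚ.≤-trans s₀≤ν+2 (ℕₚ.≤-trans (ℕₚ.≤-reflexive (ℕₚ.+-comm ν 2)) (s≤s ν<n))
    open Unstable n s₀≤n+1
    n∸J≤ν+1 : n ℕ.∸ J ≤ suc ν
    n∸J≤ν+1 with s₀ | 2≤s₀ | s₀≤n+1 | s₀≤ν+2
    ... | suc s₀′ | _ | s≤s s₀′≤n | s₀≤ν+2′ = subst (_≤ suc ν) (sym (ℕₚ.m∸[m∸n]≡n s₀′≤n))
      (ℕₚ.≤-pred (subst (suc s₀′ ≤_) (ℕₚ.+-comm ν 2) s₀≤ν+2′))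

  at-most-unstable-shallow : ∀ n → n ≤ ν → AtMostUnstable α (2 ℕ.^ suc ν) n
  at-most-unstable-shallow n n≤ν vs vs! _ = ℕₚ.≤-trans
    (count-congruent 0 (λ _ → ⊤) (λ {v} {w} _ _ → 1∣ (code v - code w)) vs vs! (All.universal (λ _ → tt) vs))
    (ℕₚ.^-monoʳ-≤ 2 (ℕₚ.≤-trans n≤ν (ℕₚ.n≤1+n ν)))

  at-most-unstable : ∀ n → AtMostUnstable α (2 ℕ.^ suc ν) n
  at-most-unstable n with suc ν ℕ.≤? n
  ... | yes ν<n = at-most-unstable-deep n ν<n
  ... | no  ν≮n = at-most-unstable-shallow n (ℕₚ.≤-pred (ℕₚ.≰⇒> ν≮n))

-- The hypotheses k ≠ ±1 are implied by the existence of ν.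
corollary4p9 : (k m : ℤ₂) → IsUnit k → ¬ (k ≈₂ one₂) → ¬ (k ≈₂ minusOne₂) →
    (ν : ℕ) → V2QuarterSqMinusOne k ν →
    UniformlySettled (powℤ₂ γ m · z k) ×
    (∀ n → suc ν ≤ n → AtMostUnstable (powℤ₂ γ m · z k) (2 ℕ.^ suc ν) n)
corollary4p9 k m k-odd _ _ ν hyp =
  (2 ℕ.^ suc ν , ℕₚ.m^n>0 2 (suc ν) , λ n _ → at-most-unstable k m k-odd ν hyp n) ,
  at-most-unstable-deep k m k-odd ν hyp
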